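{- Let $G$ and $F$ be finite simple graphs with $u\in V(G)$ and $v\in V(F)$, where $u$ is not isolated in $G$ and $v$ is not isolated in $F$, and let $H=G\,{}_u\!\cdot_v F$ be their one point join. Then $2\gamma(H)=\gamma(G)\gamma(F)$.
   Context: The one point join $G\,{}_u\!\cdot_v F$ is the graph formed from the disjoint union of $G$ and $F$ by identifying the vertices $u$ and $v$. For a finite simple graph $K$, $q_N(K;x)=\sum_{W\subseteq V(K)}(x-1)^{n(K[W])}$, where $n(K[W])$ is the $\mathbb{F}_2$-nullity of the adjacency matrix of the induced subgraph $K[W]$ (the empty set contributing $1$), and $\gamma(K)$ is the coefficient of $x^1$ in $q_N(K;x)$. -}

module Defs where

open import Data.Bool using (Bool; true; false; _∧_; _xor_; if_then_else_)
open import Data.Nat using (ℕ; zero; suc; _+_)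
open import Data.Nat.Combinatorics using (_C_)
open import Data.Nat.Logarithm using (⌊log₂_⌋)
open import Data.Integer using (ℤ; +_; -_) renaming (_+_ to _+ℤ_; _*_ to _*ℤ_)
open import Data.Fin using (Fin; zero; suc; splitAt; punchIn; _≟_)
open import Data.Sum using (inj₁; inj₂)
open import Data.Vec using (Vec; []; _∷_; lookup)
open import Data.List using (List; []; _∷_; map; _++_; length; foldr; filter)
import Data.List as List
open import Data.Product using (∃; _×_)
open import Relation.Binary.PropositionalEquality using (_≡_)
open import Relation.Nullary.Decidable using (⌊_⌋)

Graph : ℕ → Set
Graph n = Fin n → Fin n → Bool

IsSimple : ∀ {n} → Graph n → Set
IsSimple {n} A = (∀ (i j : Fin n) → A i j ≡ A j i) × (∀ (i : Fin n) → A i i ≡ false)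

NonIsolated : ∀ {n} → Graph n → Fin n → Set
NonIsolated A u = ∃ λ w → A u w ≡ true

-- Vertices of H : Fin (m + k) with the first m
-- being the vertices of G and the remaining k being the vertices of F other
-- than v (vertex w ≠ v of F corresponds to j with punchIn v j = w); the vertex
-- v of F is identified with u of G.
onePointJoin : ∀ {m k} → Graph m → Graph (suc k) → Fin m → Fin (suc k) → Graph (m + k)
onePointJoin {m} {k} G F u v a b with splitAt m a | splitAt m b
... | inj₁ a' | inj₁ b' = G a' b'
... | inj₂ a' | inj₂ b' = F (punchIn v a') (punchIn v b')
... | inj₁ a' | inj₂ b' = if ⌊ a' ≟ u ⌋ then F v (punchIn v b') else false
... | inj₂ a' | inj₁ b' = if ⌊ b' ≟ u ⌋ then F (punchIn v a') v else false

-- All vectors in 𝔽₂^n (Bool = 𝔽₂); also all subsets of Fin n.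
allVecs : (n : ℕ) → List (Vec Bool n)
allVecs zero = [] ∷ []
allVecs (suc n) = map (false ∷_) (allVecs n) ++ map (true ∷_) (allVecs n)

xorSum : (p : ℕ) → (Fin p → Bool) → Bool
xorSum zero f = false
xorSum (suc p) f = f zero xor xorSum p (λ i → f (suc i))

allB : (p : ℕ) → (Fin p → Bool) → Bool
allB zero f = true
allB (suc p) f = f zero ∧ allB p (λ i → f (suc i))

inKernel : ∀ {p} → (Fin p → Fin p → Bool) → Vec Bool p → Bool
inKernel {p} M x = allB p (λ i → if xorSum p (λ j → M i j ∧ lookup x j) then false else true)

-- 𝔽₂-nullity: the null space is a subspace of size 2^d; d = log₂ of its size.
nullity : ∀ {p} → (Fin p → Fin p → Bool) → ℕ
nullity {p} M = ⌊log₂ length (filter (λ x → Data.Bool._≟_ (inKernel M x) true) (allVecs p)) ⌋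
  where import Data.Bool

-- Induced subgraph K[W]: vertices of W listed in increasing order.
members : ∀ {n} → Vec Bool n → List (Fin n)
members [] = []
members (false ∷ w) = map suc (members w)
members (true ∷ w) = zero ∷ map suc (members w)

induced : ∀ {n} → Graph n → (W : Vec Bool n) → Graph (length (members W))
induced K W i j = K (List.lookup (members W) i) (List.lookup (members W) j)

signℤ : ℕ → ℤ
signℤ zero = + 1
signℤ (suc e) = - signℤ e

-- coefficient of x^j in (x-1)^d
coeffPow : ℕ → ℕ → ℤ
coeffPow d j = signℤ (d Data.Nat.∸ j) *ℤ (+ (d C j))
  where import Data.Nat

sumℤ : List ℤ → ℤ
sumℤ = foldr _+ℤ_ (+ 0)

-- coefficient of x^j in q_N(K;x) = Σ_{W ⊆ V(K)} (x-1)^{n(K[W])}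
-- (the empty W gives nullity 0, contributing 1).
qNcoeff : ∀ {n} → Graph n → ℕ → ℤ
qNcoeff {n} K j = sumℤ (map (λ W → coeffPow (nullity (induced K W)) j) (allVecs n))

γ : ∀ {n} → Graph n → ℤ
γ K = qNcoeff K 1

{-# OPTIONS --safe #-}
module Submission where

-- Over 𝔽₂ the adjacency matrix of a simple graph is alternating, so adding a vertex w ∉ W to W changes the
-- nullity of K[W] by exactly one: it goes up iff column w restricted to W lies in the column space of K[W]
-- (w is consistent on W), and down otherwise. The coefficient of x in (x-1)^d is c(d) = d(-1)^(d-1), and
-- c(d) + c(d+1) = (-1)^d; pairing W with W ∪ {w} therefore gives
--   γ(K) = 2 Σ_{W ∌ w, w consistent on W} (-1)^n(K[W]) - Σ_{W ∌ w} (-1)^n(K[W]),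
-- and the last sum vanishes (pair along a second vertex w′). For the join H with w the identified vertex, a set
-- W ∌ w is W₁ ⊔ W₂ with H[W] = G[W₁] ⊔ F[W₂]: nullities add and consistency holds iff it holds in G and in F,
-- so the first sum for H is the product of those for G and F, and 2γ(H) = γ(G)γ(F). Non-isolation of u and v
-- is only used to provide the second vertices.

open import Defs
open import Data.Nat using (ℕ; suc)
open import Data.Fin using (Fin)
open import Data.Integer using (ℤ; +_; _*_)
open import Relation.Binary.PropositionalEquality using (_≡_)

open import Algebra.Bundles using (CommutativeRing; CommutativeSemigroup)
open import Algebra.Core using (Op₂)
open import Algebra.Structures using (IsSemiring)
open import Data.Bool using (Bool; true; false; not; _∧_; _xor_; if_then_else_)
import Data.Bool as Bool
open import Data.Bool.Properties
  using (xor-∧-commutativeRing; ¬-not; xor-assoc; xor-comm; xor-same; xor-identityʳ; not-injective;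
         ∧-comm; ∧-zeroʳ; ∧-conicalʳ; ∧-identityʳ; ∧-distribˡ-xor; ∧-distribʳ-xor)
open import Data.Bool.Solver using (module xor-∧-Solver)
open import Data.Fin using (zero; suc; punchIn; punchOut; _↑ˡ_; _↑ʳ_; splitAt; cast; _≟_)
import Data.Fin.Properties as Fin
open import Data.Fin.Subset using (Subset; ∣_∣)
open import Data.Integer using (-_; _+_; -1ℤ)
import Data.Integer.Properties as ℤ
open import Data.Integer.Tactic.RingSolver using (solve-∀)
open import Data.List using (List; foldr; length; filter)
import Data.List as List
open import Data.List.Properties using (map-++; map-∘)
open import Data.Nat using (zero; _^_)
import Data.Nat as ℕ
import Data.Nat.Properties as ℕ
open import Data.Nat.Combinatorics using (nC1≡n)
open import Data.Nat.Logarithm using (⌊log₂_⌋; ⌊log₂[2^n]⌋≡n)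
open import Data.Product using (Σ-syntax; ∃; ∃-syntax; _×_; _,_; proj₁; proj₂)
open import Data.Sum using (_⊎_; inj₁; inj₂)
open import Data.Vec using (Vec; []; _∷_; lookup; replicate; zipWith; _[_]≔_; _++_; insertAt; map; toList)
open import Data.Vec.Properties
  using (lookup-zipWith; lookup-replicate; lookup∘update; lookup∘update′; lookup-++ˡ; lookup-++ʳ;
         insertAt-lookup; insertAt-punchIn; lookup-map; toList-map; length-toList)
open import Function using (_∘_)
open import Function.Bundles using (_⇔_; mk⇔; Equivalence)
open import Function.Construct.Composition using (_⇔-∘_)
open import Level using (0ℓ)
open import Relation.Binary.PropositionalEquality using (_≢_; refl; sym; trans; cong; cong₂; subst; module ≡-Reasoning)
open import Relation.Nullary using (Dec; yes; no; does; ¬_; contradiction)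
open import Relation.Nullary.Decidable using (⌊_⌋; dec-false; does-⇔; map′; _×-dec_; _→-dec_)
open import Relation.Unary using (Pred; Decidable)

open import Algebra.Properties.Semiring.Sum (CommutativeRing.semiring xor-∧-commutativeRing)
  using (sum; sum-cong-≗; sum-remove; sum-replicate-zero; ∑-distrib-+; ∑-comm; *-distribʳ-sum)

open xor-∧-Solver using (solve; _:=_; _:*_; con)
open ≡-Reasoning

-- Linear algebra over 𝔽₂

true≢false : true ≢ false
true≢false ()

xor-cancelʳ : ∀ a b → (a xor b) xor b ≡ a
xor-cancelʳ a b = begin
  (a xor b) xor b ≡⟨ xor-assoc a b b ⟩
  a xor (b xor b) ≡⟨ cong (a xor_) (xor-same b) ⟩
  a xor false     ≡⟨ xor-identityʳ a ⟩
  a               ∎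

xor-false⇒≡ : ∀ {a b} → a xor b ≡ false → a ≡ b
xor-false⇒≡ {true}  {true}  _ = refl
xor-false⇒≡ {false} {false} _ = refl

xorSum≡sum : ∀ p (f : Fin p → Bool) → xorSum p f ≡ sum f
xorSum≡sum zero    f = refl
xorSum≡sum (suc p) f = cong (f zero xor_) (xorSum≡sum p (f ∘ suc))

sum-↑ : ∀ m k (f : Fin (m ℕ.+ k) → Bool) → sum f ≡ sum (f ∘ (_↑ˡ k)) xor sum (f ∘ (m ↑ʳ_))
sum-↑ zero    k f = refl
sum-↑ (suc m) k f = trans (cong (f zero xor_) (sum-↑ m k (f ∘ suc))) (sym (xor-assoc (f zero) _ _))

infix 7 _·_
_·_ : ∀ {n} → (Fin n → Bool) → (Fin n → Bool) → Bool
u · v = sum (λ j → u j ∧ v j)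

·-comm : ∀ {n} (u v : Fin n → Bool) → u · v ≡ v · u
·-comm u v = sum-cong-≗ (λ j → ∧-comm (u j) (v j))

·-congˡ : ∀ {n} (u : Fin n → Bool) {v v′ : Fin n → Bool} → (∀ j → v j ≡ v′ j) → u · v ≡ u · v′
·-congˡ u v≗v′ = sum-cong-≗ (λ j → cong (u j ∧_) (v≗v′ j))

·-congʳ : ∀ {n} {u u′ : Fin n → Bool} (v : Fin n → Bool) →
          (∀ j → v j ≡ true → u j ≡ u′ j) → u · v ≡ u′ · v
·-congʳ {u = u} {u′} v u≡u′ = sum-cong-≗ pointwise
  where
  pointwise : ∀ j → u j ∧ v j ≡ u′ j ∧ v j
  pointwise j with v j in vj
  ... | true  = cong (_∧ true) (u≡u′ j vj)
  ... | false = trans (∧-zeroʳ (u j)) (sym (∧-zeroʳ (u′ j)))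

·-zeroˡ : ∀ {n} (v : Fin n → Bool) → (λ _ → false) · v ≡ false
·-zeroˡ {n} v = sum-replicate-zero n

·-zeroʳ : ∀ {n} (u : Fin n → Bool) → u · (λ _ → false) ≡ false
·-zeroʳ u = trans (·-comm u _) (·-zeroˡ u)

·-distribʳ-xor : ∀ {n} (u u′ v : Fin n → Bool) → (λ j → u j xor u′ j) · v ≡ u · v xor u′ · v
·-distribʳ-xor u u′ v = trans (sum-cong-≗ (λ j → ∧-distribʳ-xor (v j) (u j) (u′ j)))
  (∑-distrib-+ (λ j → u j ∧ v j) (λ j → u′ j ∧ v j))

·-distribˡ-xor : ∀ {n} (u v v′ : Fin n → Bool) → u · (λ j → v j xor v′ j) ≡ u · v xor u · v′
·-distribˡ-xor u v v′ = trans (sum-cong-≗ (λ j → ∧-distribˡ-xor (u j) (v j) (v′ j)))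
  (∑-distrib-+ (λ j → u j ∧ v j) (λ j → u j ∧ v′ j))

·-update : ∀ {n} (u : Fin n → Bool) (x : Vec Bool n) w → lookup x w ≡ false →
           u · lookup (x [ w ]≔ true) ≡ u · lookup x xor u w
·-update {suc n} u x w xw = begin
  u · lookup x′                                ≡⟨ sum-remove {i = w} (λ j → u j ∧ lookup x′ j) ⟩
  (u w ∧ lookup x′ w) xor rest x′              ≡⟨ cong₂ (λ a b → (u w ∧ a) xor b) (lookup∘update w x true) off-w ⟩
  (u w ∧ true) xor rest x                      ≡⟨ cong (_xor rest x) (∧-identityʳ (u w)) ⟩
  u w xor rest x                               ≡⟨ xor-comm (u w) (rest x) ⟩
  rest x xor u w                               ≡⟨ cong (λ a → (a xor rest x) xor u w) (sym (∧-zeroʳ (u w))) ⟩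
  ((u w ∧ false) xor rest x) xor u w           ≡⟨ cong (λ a → ((u w ∧ a) xor rest x) xor u w) (sym xw) ⟩
  ((u w ∧ lookup x w) xor rest x) xor u w      ≡⟨ cong (_xor u w) (sym (sum-remove {i = w} (λ j → u j ∧ lookup x j))) ⟩
  u · lookup x xor u w                         ∎
  where
  x′ : Vec Bool (suc n)
  x′ = x [ w ]≔ true
  rest : Vec Bool (suc n) → Bool
  rest y = sum (λ j → u (punchIn w j) ∧ lookup y (punchIn w j))
  off-w : rest x′ ≡ rest x
  off-w = sum-cong-≗ (λ j → cong (u (punchIn w j) ∧_) (lookup∘update′ (Fin.punchInᵢ≢i w j) x true))

unit : ∀ {n} → Fin n → Vec Bool n
unit {n} i = replicate n false [ i ]≔ true

unit-· : ∀ {n} (i : Fin n) (v : Fin n → Bool) → lookup (unit i) · v ≡ v i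
unit-· {n} i v = begin
  lookup (unit i) · v                        ≡⟨ ·-comm (lookup (unit i)) v ⟩
  v · lookup (unit i)                        ≡⟨ ·-update v (replicate n false) i (lookup-replicate i false) ⟩
  v · lookup (replicate n false) xor v i     ≡⟨ cong (_xor v i) (·-congˡ v (λ j → lookup-replicate j false)) ⟩
  v · (λ _ → false) xor v i                  ≡⟨ cong (_xor v i) (·-zeroʳ v) ⟩
  v i                                        ∎

infixl 6 _⊕_
_⊕_ : ∀ {n} → Vec Bool n → Vec Bool n → Vec Bool n
_⊕_ = zipWith _xor_

lookup-⊕ : ∀ {n} (x y : Vec Bool n) j → lookup (x ⊕ y) j ≡ lookup x j xor lookup y j
lookup-⊕ x y j = lookup-zipWith _xor_ j x y

⊕-cancelʳ : ∀ {n} (x y : Vec Bool n) → (x ⊕ y) ⊕ y ≡ x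
⊕-cancelʳ []      []      = refl
⊕-cancelʳ (a ∷ x) (b ∷ y) = cong₂ _∷_ (xor-cancelʳ a b) (⊕-cancelʳ x y)

·-⊕ˡ : ∀ {n} (x y : Vec Bool n) (v : Fin n → Bool) → lookup (x ⊕ y) · v ≡ lookup x · v xor lookup y · v
·-⊕ˡ x y v = trans (sum-cong-≗ (λ j → cong (_∧ v j) (lookup-⊕ x y j))) (·-distribʳ-xor (lookup x) (lookup y) v)

Matrix : ℕ → ℕ → Set
Matrix p q = Fin p → Fin q → Bool

infixl 7 _*ᵥ_
_*ᵥ_ : ∀ {p q} → Matrix p q → Vec Bool q → Fin p → Bool
(M *ᵥ x) i = M i · lookup x

*ᵥ-⊕ : ∀ {p q} (M : Matrix p q) x y i → (M *ᵥ (x ⊕ y)) i ≡ (M *ᵥ x) i xor (M *ᵥ y) i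
*ᵥ-⊕ M x y i = trans (·-congˡ (M i) (lookup-⊕ x y)) (·-distribˡ-xor (M i) (lookup x) (lookup y))

*ᵥ-update : ∀ {p q} (M : Matrix p q) x w → lookup x w ≡ false →
            ∀ i → (M *ᵥ (x [ w ]≔ true)) i ≡ (M *ᵥ x) i xor M i w
*ᵥ-update M x w xw i = ·-update (M i) x w xw

Symmetric : ∀ {n} → Matrix n n → Set
Symmetric {n} K = ∀ (i j : Fin n) → K i j ≡ K j i

*ᵥ-symmetric : ∀ {n} {K : Matrix n n} → Symmetric K → ∀ x y → (K *ᵥ x) · lookup y ≡ (K *ᵥ y) · lookup x
*ᵥ-symmetric {n} {K} K-sym x y = begin
  sum (λ i → sum (λ j → K i j ∧ lookup x j) ∧ lookup y i)
    ≡⟨ sum-cong-≗ (λ i → *-distribʳ-sum (lookup y i) (λ j → K i j ∧ lookup x j)) ⟩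
  sum (λ i → sum (λ j → (K i j ∧ lookup x j) ∧ lookup y i))
    ≡⟨ ∑-comm (λ i j → (K i j ∧ lookup x j) ∧ lookup y i) ⟩
  sum (λ j → sum (λ i → (K i j ∧ lookup x j) ∧ lookup y i))
    ≡⟨ sum-cong-≗ (λ j → sum-cong-≗ (λ i → reorder i j)) ⟩
  sum (λ j → sum (λ i → (K j i ∧ lookup y i) ∧ lookup x j))
    ≡⟨ sum-cong-≗ (λ j → *-distribʳ-sum (lookup x j) (λ i → K j i ∧ lookup y i)) ⟨
  sum (λ j → sum (λ i → K j i ∧ lookup y i) ∧ lookup x j)
    ∎
  where
  reorder : ∀ i j → (K i j ∧ lookup x j) ∧ lookup y i ≡ (K j i ∧ lookup y i) ∧ lookup x j
  reorder i j rewrite K-sym i j = solve 3 (λ k a b → (k :* a) :* b := (k :* b) :* a) refl (K j i) (lookup x j) (lookup y i)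

∑∑-alternating : ∀ n (A : Matrix n n) → Symmetric A → (∀ i → A i i ≡ false) → sum (λ i → sum (A i)) ≡ false
∑∑-alternating zero    A A-sym A-diag = refl
∑∑-alternating (suc n) A A-sym A-diag = begin
  (A zero zero xor r) xor sum (λ i → A (suc i) zero xor sum (λ j → A (suc i) (suc j)))
    ≡⟨ cong₂ (λ a b → (a xor r) xor b) (A-diag zero) (∑-distrib-+ (λ i → A (suc i) zero) _) ⟩
  r xor (sum (λ i → A (suc i) zero) xor sum (λ i → sum (λ j → A (suc i) (suc j))))
    ≡⟨ cong₂ (λ a b → r xor (a xor b)) (sum-cong-≗ (λ i → A-sym (suc i) zero))
         (∑∑-alternating n (λ i j → A (suc i) (suc j)) (λ i j → A-sym (suc i) (suc j)) (A-diag ∘ suc)) ⟩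
  r xor (r xor false) ≡⟨ cong (r xor_) (xor-identityʳ r) ⟩
  r xor r             ≡⟨ xor-same r ⟩
  false               ∎
  where
  r : Bool
  r = sum (λ j → A zero (suc j))

*ᵥ-alternating : ∀ {n} {K : Graph n} → IsSimple K → ∀ x → (K *ᵥ x) · lookup x ≡ false
*ᵥ-alternating {n} {K} (K-sym , K-loopless) x = begin
  sum (λ i → sum (λ j → K i j ∧ lookup x j) ∧ lookup x i)
    ≡⟨ sum-cong-≗ (λ i → *-distribʳ-sum (lookup x i) (λ j → K i j ∧ lookup x j)) ⟩
  sum (λ i → sum (A i))
    ≡⟨ ∑∑-alternating n A A-sym A-diag ⟩
  false ∎
  where
  A : Matrix n n
  A i j = (K i j ∧ lookup x j) ∧ lookup x i
  A-sym : Symmetric A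
  A-sym i j rewrite K-sym i j = solve 3 (λ k a b → (k :* a) :* b := (k :* b) :* a) refl (K j i) (lookup x j) (lookup x i)
  A-diag : ∀ i → A i i ≡ false
  A-diag i rewrite K-loopless i = refl

Solution : ∀ {p q} → Matrix p q → (Fin p → Bool) → Set
Solution {q = q} M b = Σ[ x ∈ Vec Bool q ] (∀ i → (M *ᵥ x) i ≡ b i)

Obstruction : ∀ {p q} → Matrix p q → (Fin p → Bool) → Set
Obstruction {p} M b = Σ[ y ∈ Vec Bool p ] (∀ j → lookup y · (λ i → M i j) ≡ false) × lookup y · b ≡ true

module FredholmStep {p q} (M : Matrix p (suc q)) (b : Fin p → Bool) where
  c : Fin p → Bool
  c i = M i zero

  M′ : Matrix p q
  M′ i j = M i (suc j)

  b⊕c : Fin p → Bool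
  b⊕c i = b i xor c i

  from-solution : Solution M′ b → Solution M b
  from-solution (x , M′x≡b) = false ∷ x , λ i → trans (cong (_xor (M′ *ᵥ x) i) (∧-zeroʳ (c i))) (M′x≡b i)

  from-shifted-solution : Solution M′ b⊕c → Solution M b
  from-shifted-solution (x , M′x≡b⊕c) = true ∷ x , λ i → begin
    (c i ∧ true) xor (M′ *ᵥ x) i ≡⟨ cong₂ _xor_ (∧-identityʳ (c i)) (M′x≡b⊕c i) ⟩
    c i xor (b i xor c i)        ≡⟨ xor-comm (c i) (b i xor c i) ⟩
    (b i xor c i) xor c i        ≡⟨ xor-cancelʳ (b i) (c i) ⟩
    b i                          ∎

  private
    extend : ∀ y → lookup y · c ≡ false → (∀ j → lookup y · (λ i → M′ i j) ≡ false) →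
             ∀ j → lookup y · (λ i → M i j) ≡ false
    extend _ yc≡0 yM′≡0 zero    = yc≡0
    extend _ yc≡0 yM′≡0 (suc j) = yM′≡0 j

    ·-b : ∀ z → lookup z · b ≡ lookup z · b⊕c xor lookup z · c
    ·-b z = begin
      lookup z · b                                ≡⟨ ·-congˡ (lookup z) (λ i → xor-cancelʳ (b i) (c i)) ⟨
      lookup z · (λ i → b⊕c i xor c i)            ≡⟨ ·-distribˡ-xor (lookup z) b⊕c c ⟩
      lookup z · b⊕c xor lookup z · c             ∎

  -- If both certificates see the first column, their sum does not.
  combine : Obstruction M′ b → Obstruction M′ b⊕c → Obstruction M b
  combine (y , yM′≡0 , yb≡1) (z , zM′≡0 , zb⊕c≡1) with lookup y · c in yc | lookup z · c in zc
  ... | false | _     = y , extend y yc yM′≡0 , yb≡1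
  ... | true  | false = z , extend z zc zM′≡0 , trans (·-b z) (cong₂ _xor_ zb⊕c≡1 zc)
  ... | true  | true  = y ⊕ z , extend (y ⊕ z) (trans (·-⊕ˡ y z c) (cong₂ _xor_ yc zc)) y⊕zM′≡0 ,
                        trans (·-⊕ˡ y z b) (cong₂ _xor_ yb≡1 (trans (·-b z) (cong₂ _xor_ zb⊕c≡1 zc)))
    where
    y⊕zM′≡0 : ∀ j → lookup (y ⊕ z) · (λ i → M′ i j) ≡ false
    y⊕zM′≡0 j = trans (·-⊕ˡ y z _) (cong₂ _xor_ (yM′≡0 j) (zM′≡0 j))

  step : Solution M′ b ⊎ Obstruction M′ b → Solution M′ b⊕c ⊎ Obstruction M′ b⊕c →
         Solution M b ⊎ Obstruction M b
  step (inj₁ s) _        = inj₁ (from-solution s)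
  step (inj₂ _) (inj₁ s) = inj₁ (from-shifted-solution s)
  step (inj₂ o) (inj₂ o′) = inj₂ (combine o o′)

fredholm : ∀ {p} q (M : Matrix p q) b → Solution M b ⊎ Obstruction M b
fredholm zero M b with Fin.any? (λ i → b i Bool.≟ true)
... | yes (i , bi) = inj₂ (unit i , (λ ()) , trans (unit-· i b) bi)
... | no ∄i        = inj₁ ([] , λ i → sym (¬-not (λ bi → ∄i (i , bi))))
fredholm (suc q) M b = step (fredholm q M′ b) (fredholm q M′ b⊕c)
  where open FredholmStep M b

-- Sums over the cube 𝔽₂ⁿ

module CubeSum {A : Set} {_+_ _*_ : Op₂ A} {0# 1# : A} (isSemiring : IsSemiring _≡_ _+_ _*_ 0# 1#) where
  open IsSemiring isSemiring
    using (+-assoc; +-comm; +-identityˡ; +-identityʳ; distribˡ; distribʳ; +-isCommutativeSemigroup)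
  private
    +-commutativeSemigroup : CommutativeSemigroup 0ℓ 0ℓ
    +-commutativeSemigroup = record { isCommutativeSemigroup = +-isCommutativeSemigroup }

  open import Algebra.Properties.CommutativeSemigroup +-commutativeSemigroup using (interchange)

  cubeSum : ∀ n → (Vec Bool n → A) → A
  cubeSum zero    f = f []
  cubeSum (suc n) f = cubeSum n (f ∘ (false ∷_)) + cubeSum n (f ∘ (true ∷_))

  cubeSum-cong : ∀ n {f g : Vec Bool n → A} → (∀ x → f x ≡ g x) → cubeSum n f ≡ cubeSum n g
  cubeSum-cong zero    f≗g = f≗g []
  cubeSum-cong (suc n) f≗g = cong₂ _+_ (cubeSum-cong n (f≗g ∘ (false ∷_))) (cubeSum-cong n (f≗g ∘ (true ∷_)))

  cubeSum-distrib-+ : ∀ n (f g : Vec Bool n → A) → cubeSum n (λ x → f x + g x) ≡ cubeSum n f + cubeSum n g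
  cubeSum-distrib-+ zero    f g = refl
  cubeSum-distrib-+ (suc n) f g = trans
    (cong₂ _+_ (cubeSum-distrib-+ n (f ∘ (false ∷_)) (g ∘ (false ∷_)))
               (cubeSum-distrib-+ n (f ∘ (true ∷_)) (g ∘ (true ∷_))))
    (interchange _ _ _ _)

  cubeSum-zero : ∀ n → cubeSum n (λ _ → 0#) ≡ 0#
  cubeSum-zero zero    = refl
  cubeSum-zero (suc n) = trans (cong₂ _+_ (cubeSum-zero n) (cubeSum-zero n)) (+-identityˡ 0#)

  *-distribˡ-cubeSum : ∀ n a (f : Vec Bool n → A) → cubeSum n (λ x → a * f x) ≡ a * cubeSum n f
  *-distribˡ-cubeSum zero    a f = refl
  *-distribˡ-cubeSum (suc n) a f =
    trans (cong₂ _+_ (*-distribˡ-cubeSum n a _) (*-distribˡ-cubeSum n a _)) (sym (distribˡ a _ _))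

  *-distribʳ-cubeSum : ∀ n a (f : Vec Bool n → A) → cubeSum n (λ x → f x * a) ≡ cubeSum n f * a
  *-distribʳ-cubeSum zero    a f = refl
  *-distribʳ-cubeSum (suc n) a f =
    trans (cong₂ _+_ (*-distribʳ-cubeSum n a _) (*-distribʳ-cubeSum n a _)) (sym (distribʳ a _ _))

  cubeSum-translate : ∀ n (f : Vec Bool n → A) a → cubeSum n (λ x → f (x ⊕ a)) ≡ cubeSum n f
  cubeSum-translate zero    f []          = refl
  cubeSum-translate (suc n) f (false ∷ a) =
    cong₂ _+_ (cubeSum-translate n (f ∘ (false ∷_)) a) (cubeSum-translate n (f ∘ (true ∷_)) a)
  cubeSum-translate (suc n) f (true ∷ a)  = trans
    (cong₂ _+_ (cubeSum-translate n (f ∘ (true ∷_)) a) (cubeSum-translate n (f ∘ (false ∷_)) a))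
    (+-comm _ _)

  cubeSum-++ : ∀ m k (f : Vec Bool (m ℕ.+ k) → A) →
               cubeSum (m ℕ.+ k) f ≡ cubeSum m (λ x → cubeSum k (λ y → f (x ++ y)))
  cubeSum-++ zero    k f = refl
  cubeSum-++ (suc m) k f = cong₂ _+_ (cubeSum-++ m k (f ∘ (false ∷_))) (cubeSum-++ m k (f ∘ (true ∷_)))

  cubeSum-insertAt : ∀ k (f : Vec Bool (suc k) → A) v →
    cubeSum (suc k) f ≡ cubeSum k (λ x → f (insertAt x v false) + f (insertAt x v true))
  cubeSum-insertAt k       f zero    = sym (cubeSum-distrib-+ k _ _)
  cubeSum-insertAt (suc k) f (suc v) =
    cong₂ _+_ (cubeSum-insertAt k (f ∘ (false ∷_)) v) (cubeSum-insertAt k (f ∘ (true ∷_)) v)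

  cubeSum-pairs : ∀ n (f : Vec Bool n → A) w →
    cubeSum n f ≡ cubeSum n (λ x → if lookup x w then 0# else f x + f (x [ w ]≔ true))
  cubeSum-pairs (suc n) f zero = begin
    cubeSum n (f ∘ (false ∷_)) + cubeSum n (f ∘ (true ∷_)) ≡⟨ cubeSum-distrib-+ n _ _ ⟨
    pairSum                                                ≡⟨ +-identityʳ pairSum ⟨
    pairSum + 0#                                           ≡⟨ cong (λ s → pairSum + s) (cubeSum-zero n) ⟨
    pairSum + cubeSum n (λ _ → 0#)                         ∎
    where
    pairSum : A
    pairSum = cubeSum n (λ x → f (false ∷ x) + f (true ∷ x))
  cubeSum-pairs (suc n) f (suc w) =
    cong₂ _+_ (cubeSum-pairs n (f ∘ (false ∷_)) w) (cubeSum-pairs n (f ∘ (true ∷_)) w)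

  cubeSum-join : ∀ m k v {h : Vec Bool (m ℕ.+ k) → A} {f : Vec Bool m → A} {g : Vec Bool (suc k) → A} →
    (∀ x y → h (x ++ y) ≡ f x * g (insertAt y v false)) → (∀ y → g (insertAt y v true) ≡ 0#) →
    cubeSum (m ℕ.+ k) h ≡ cubeSum m f * cubeSum (suc k) g
  cubeSum-join m k v {h} {f} {g} h-split g-vanishes = begin
    cubeSum (m ℕ.+ k) h
      ≡⟨ cubeSum-++ m k h ⟩
    cubeSum m (λ x → cubeSum k (λ y → h (x ++ y)))
      ≡⟨ cubeSum-cong m (λ x → cubeSum-cong k (h-split x)) ⟩
    cubeSum m (λ x → cubeSum k (λ y → f x * g (insertAt y v false)))
      ≡⟨ cubeSum-cong m (λ x → *-distribˡ-cubeSum k (f x) _) ⟩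
    cubeSum m (λ x → f x * g′)
      ≡⟨ *-distribʳ-cubeSum m g′ f ⟩
    cubeSum m f * g′
      ≡⟨ cong (cubeSum m f *_) g′≡ ⟩
    cubeSum m f * cubeSum (suc k) g ∎
    where
    g′ : A
    g′ = cubeSum k (λ y → g (insertAt y v false))
    g′≡ : g′ ≡ cubeSum (suc k) g
    g′≡ = sym (trans (cubeSum-insertAt k g v)
      (cubeSum-cong k (λ y → trans (cong (λ s → g (insertAt y v false) + s) (g-vanishes y)) (+-identityʳ _))))

  listSum : List A → A
  listSum = foldr _+_ 0#

  listSum-++ : ∀ xs ys → listSum (xs List.++ ys) ≡ listSum xs + listSum ys
  listSum-++ List.[]       ys = sym (+-identityˡ _)
  listSum-++ (x List.∷ xs) ys = trans (cong (λ s → x + s) (listSum-++ xs ys)) (sym (+-assoc x _ _))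

  listSum-allVecs : ∀ n (f : Vec Bool n → A) → listSum (List.map f (allVecs n)) ≡ cubeSum n f
  listSum-allVecs zero    f = +-identityʳ (f [])
  listSum-allVecs (suc n) f = begin
    listSum (List.map f (List.map (false ∷_) vs List.++ List.map (true ∷_) vs))
      ≡⟨ cong listSum (map-++ f (List.map (false ∷_) vs) _) ⟩
    listSum (List.map f (List.map (false ∷_) vs) List.++ List.map f (List.map (true ∷_) vs))
      ≡⟨ listSum-++ (List.map f (List.map (false ∷_) vs)) _ ⟩
    listSum (List.map f (List.map (false ∷_) vs)) + listSum (List.map f (List.map (true ∷_) vs))
      ≡⟨ cong₂ _+_ (trans (cong listSum (sym (map-∘ vs))) (listSum-allVecs n (f ∘ (false ∷_))))
                   (trans (cong listSum (sym (map-∘ vs))) (listSum-allVecs n (f ∘ (true ∷_)))) ⟩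
    cubeSum (suc n) f ∎
    where
    vs : List (Vec Bool n)
    vs = allVecs n

-- Counting solutions of linear systems supported on a vertex set

module ℕΣ = CubeSum ℕ.+-*-isSemiring

𝟙 : Bool → ℕ
𝟙 true  = 1
𝟙 false = 0

positive : ℕ → Bool
positive zero    = false
positive (suc _) = true

double : ∀ a → a ℕ.+ a ≡ 2 ℕ.* a
double a = cong (a ℕ.+_) (sym (ℕ.+-identityʳ a))

𝟙-∧ : ∀ a b → 𝟙 (a ∧ b) ≡ 𝟙 a ℕ.* 𝟙 b
𝟙-∧ true  b = sym (ℕ.+-identityʳ (𝟙 b))
𝟙-∧ false b = refl

positive-* : ∀ a b → positive (a ℕ.* b) ≡ positive a ∧ positive b
positive-* zero    b       = refl
positive-* (suc a) zero    = cong positive (ℕ.*-zeroʳ a)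
positive-* (suc a) (suc b) = refl

count : ∀ {n} {P : Pred (Vec Bool n) 0ℓ} → Decidable P → ℕ
count {n} P? = ℕΣ.cubeSum n (λ x → 𝟙 (does (P? x)))

count-cong : ∀ {n} {P Q : Pred (Vec Bool n) 0ℓ} (P? : Decidable P) (Q? : Decidable Q) →
             (∀ x → P x ⇔ Q x) → count P? ≡ count Q?
count-cong {n} P? Q? P⇔Q = ℕΣ.cubeSum-cong n (λ x → cong 𝟙 (does-⇔ (P⇔Q x) (P? x) (Q? x)))

count-translate : ∀ {n} {P Q : Pred (Vec Bool n) 0ℓ} (P? : Decidable P) (Q? : Decidable Q) y →
                  (∀ x → P (x ⊕ y) ⇔ Q x) → count P? ≡ count Q?
count-translate {n} P? Q? y P⇔Q = trans (sym (ℕΣ.cubeSum-translate n (λ x → 𝟙 (does (P? x))) y))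
  (ℕΣ.cubeSum-cong n (λ x → cong 𝟙 (does-⇔ (P⇔Q x) (P? (x ⊕ y)) (Q? x))))

count-split : ∀ {n} {P : Pred (Vec Bool n) 0ℓ} (P? : Decidable P) (f : Vec Bool n → Bool) →
              count P? ≡ count (λ x → P? x ×-dec f x Bool.≟ false) ℕ.+ count (λ x → P? x ×-dec f x Bool.≟ true)
count-split {n} P? f = trans (ℕΣ.cubeSum-cong n pointwise) (ℕΣ.cubeSum-distrib-+ n _ _)
  where
  pointwise : ∀ x → 𝟙 (does (P? x))
                  ≡ 𝟙 (does (P? x) ∧ does (f x Bool.≟ false)) ℕ.+ 𝟙 (does (P? x) ∧ does (f x Bool.≟ true))
  pointwise x with does (P? x) | f x
  ... | true  | true  = refl
  ... | true  | false = refl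
  ... | false | _     = refl

count-empty : ∀ {n} {P : Pred (Vec Bool n) 0ℓ} (P? : Decidable P) → (∀ x → ¬ P x) → count P? ≡ 0
count-empty {n} P? ∄P = trans (ℕΣ.cubeSum-cong n (λ x → cong 𝟙 (dec-false (P? x) (∄P x)))) (ℕΣ.cubeSum-zero n)

positive-count⇒∃ : ∀ {n} {P : Pred (Vec Bool n) 0ℓ} (P? : Decidable P) → positive (count P?) ≡ true → ∃ P
positive-count⇒∃ {zero} P? h with P? []
... | yes p = [] , p
positive-count⇒∃ {suc n} P? h with count (P? ∘ (false ∷_)) in c₀
... | suc _ = let (x , p) = positive-count⇒∃ (P? ∘ (false ∷_)) (cong positive c₀) in false ∷ x , p
... | zero  = let (x , p) = positive-count⇒∃ (P? ∘ (true ∷_)) h in true ∷ x , p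

¬positive-count⇒∄ : ∀ {n} {P : Pred (Vec Bool n) 0ℓ} (P? : Decidable P) →
                    positive (count P?) ≡ false → ∀ x → ¬ P x
¬positive-count⇒∄ P? h [] p with P? []
... | no ¬p = ¬p p
¬positive-count⇒∄ P? h (b ∷ x) with count (P? ∘ (false ∷_)) in c₀ | count (P? ∘ (true ∷_)) in c₁
¬positive-count⇒∄ P? h (false ∷ x) | zero | zero = ¬positive-count⇒∄ (P? ∘ (false ∷_)) (cong positive c₀) x
¬positive-count⇒∄ P? h (true ∷ x)  | zero | zero = ¬positive-count⇒∄ (P? ∘ (true ∷_)) (cong positive c₁) x

infix 4 _⊆_
_⊆_ : ∀ {n} → Vec Bool n → Subset n → Set
x ⊆ W = ∀ i → lookup x i ≡ true → lookup W i ≡ true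

⊕-⊆ : ∀ {n} {W : Subset n} x y → x ⊆ W → y ⊆ W → x ⊕ y ⊆ W
⊕-⊆ x y x⊆W y⊆W i x⊕yi with lookup x i in xi
... | true  = x⊆W i xi
... | false = y⊆W i (trans (sym (cong (_xor lookup y i) xi)) (trans (sym (lookup-⊕ x y i)) x⊕yi))

-- x ⊆ W satisfies the rows in W of K x = c; for c = 0 these are the kernel vectors of K[W], padded by zeros.
record Solves {n} (K : Graph n) (W : Subset n) (c : Fin n → Bool) (x : Vec Bool n) : Set where
  constructor solves
  field
    supported : x ⊆ W
    satisfied : ∀ i → lookup W i ≡ true → (K *ᵥ x) i ≡ c i

open Solves

solves? : ∀ {n} (K : Graph n) W c → Decidable (Solves K W c)
solves? K W c x = map′ (λ (s , e) → solves s e) (λ s → supported s , satisfied s)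
  (Fin.all? (λ i → lookup x i Bool.≟ true →-dec lookup W i Bool.≟ true) ×-dec
   Fin.all? (λ i → lookup W i Bool.≟ true →-dec (K *ᵥ x) i Bool.≟ c i))

#solutions : ∀ {n} → Graph n → Subset n → (Fin n → Bool) → ℕ
#solutions K W c = count (solves? K W c)

kernelSize : ∀ {n} → Graph n → Subset n → ℕ
kernelSize K W = #solutions K W (λ _ → false)

column : ∀ {n} → Graph n → Fin n → Fin n → Bool
column K w i = K i w

-- Column w, restricted to W, lies in the column space of K[W].
consistent : ∀ {n} → Graph n → Subset n → Fin n → Bool
consistent K W w = positive (#solutions K W (column K w))

solves-outside : ∀ {n} {K : Graph n} {W c x} a → lookup x a ≡ true → lookup W a ≡ false → ¬ Solves K W c x
solves-outside a xa Wa s = true≢false (trans (sym (supported s a xa)) Wa)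

solves-translate : ∀ {n} {K : Graph n} {W c c′ c″ y} → Solves K W c′ y → (∀ i → c i ≡ c″ i xor c′ i) →
                   ∀ x → Solves K W c (x ⊕ y) ⇔ Solves K W c″ x
solves-translate {K = K} {W} {c} {c′} {c″} {y} y-sol c≡ x = mk⇔ to from
  where
  to : Solves K W c (x ⊕ y) → Solves K W c″ x
  to s = solves (subst (_⊆ W) (⊕-cancelʳ x y) (⊕-⊆ {W = W} (x ⊕ y) y (supported s) (supported y-sol))) sat
    where
    sat : ∀ i → lookup W i ≡ true → (K *ᵥ x) i ≡ c″ i
    sat i Wi = begin
      (K *ᵥ x) i                                 ≡⟨ xor-cancelʳ ((K *ᵥ x) i) ((K *ᵥ y) i) ⟨
      ((K *ᵥ x) i xor (K *ᵥ y) i) xor (K *ᵥ y) i ≡⟨ cong₂ _xor_ (sym (*ᵥ-⊕ K x y i)) (satisfied y-sol i Wi) ⟩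
      (K *ᵥ (x ⊕ y)) i xor c′ i                  ≡⟨ cong (_xor c′ i) (trans (satisfied s i Wi) (c≡ i)) ⟩
      (c″ i xor c′ i) xor c′ i                   ≡⟨ xor-cancelʳ (c″ i) (c′ i) ⟩
      c″ i                                       ∎
  from : Solves K W c″ x → Solves K W c (x ⊕ y)
  from s = solves (⊕-⊆ {W = W} x y (supported s) (supported y-sol)) λ i Wi → begin
    (K *ᵥ (x ⊕ y)) i          ≡⟨ *ᵥ-⊕ K x y i ⟩
    (K *ᵥ x) i xor (K *ᵥ y) i ≡⟨ cong₂ _xor_ (satisfied s i Wi) (satisfied y-sol i Wi) ⟩
    c″ i xor c′ i             ≡⟨ c≡ i ⟨
    c i                       ∎

#solutions≡kernelSize : ∀ {n} {K : Graph n} {W c y} → Solves K W c y → #solutions K W c ≡ kernelSize K W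
#solutions≡kernelSize {K = K} {W} {c} {y} y-sol =
  count-translate (solves? K W c) (solves? K W (λ _ → false)) y (solves-translate y-sol (λ _ → refl))

-- Adding a vertex: the kernel doubles or halves

module Insertion {n} {K : Graph n} (K-simple : IsSimple K) {W : Subset n} {w : Fin n} (w∉W : lookup W w ≡ false) where

  private
    K-sym : Symmetric K
    K-sym = proj₁ K-simple

  W′ : Subset n
  W′ = W [ w ]≔ true

  w-entry : Vec Bool n → Bool
  w-entry x = (K *ᵥ x) w

  Kernel Kernel′ ColSol : Vec Bool n → Set
  Kernel  = Solves K W  (λ _ → false)
  Kernel′ = Solves K W′ (λ _ → false)
  ColSol  = Solves K W  (column K w)

  kernel? : Decidable Kernel
  kernel? = solves? K W (λ _ → false)

  kernel′? : Decidable Kernel′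
  kernel′? = solves? K W′ (λ _ → false)

  colSol? : Decidable ColSol
  colSol? = solves? K W (column K w)

  _with-w-entry≡_ : {P : Pred (Vec Bool n) 0ℓ} → Decidable P → (b : Bool) → Decidable (λ x → P x × w-entry x ≡ b)
  (P? with-w-entry≡ b) x = P? x ×-dec w-entry x Bool.≟ b

  ∈W⇒∈W′ : ∀ i → lookup W i ≡ true → lookup W′ i ≡ true
  ∈W⇒∈W′ i Wi with i ≟ w
  ... | yes refl = contradiction (trans (sym Wi) w∉W) true≢false
  ... | no i≢w   = trans (lookup∘update′ i≢w W true) Wi

  ∈W′⇒∈W : ∀ i → i ≢ w → lookup W′ i ≡ true → lookup W i ≡ true
  ∈W′⇒∈W i i≢w W′i = trans (sym (lookup∘update′ i≢w W true)) W′i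

  w∈W′ : lookup W′ w ≡ true
  w∈W′ = lookup∘update w W true

  kernel′⇔kernel : ∀ x → lookup x w ≡ false → Kernel′ x ⇔ (Kernel x × w-entry x ≡ false)
  kernel′⇔kernel x xw = mk⇔ to from
    where
    to : Kernel′ x → Kernel x × w-entry x ≡ false
    to s = solves supp (λ i Wi → satisfied s i (∈W⇒∈W′ i Wi)) , satisfied s w w∈W′
      where
      supp : ∀ i → lookup x i ≡ true → lookup W i ≡ true
      supp i xi with i ≟ w
      ... | yes refl = contradiction (trans (sym xi) xw) true≢false
      ... | no i≢w   = ∈W′⇒∈W i i≢w (supported s i xi)
    from : Kernel x × w-entry x ≡ false → Kernel′ x
    from (s , Kxʷ≡0) = solves (λ i xi → ∈W⇒∈W′ i (supported s i xi)) sat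
      where
      sat : ∀ i → lookup W′ i ≡ true → (K *ᵥ x) i ≡ false
      sat i W′i with i ≟ w
      ... | yes refl = Kxʷ≡0
      ... | no i≢w   = satisfied s i (∈W′⇒∈W i i≢w W′i)

  kernel′⇔colSol : ∀ x → lookup x w ≡ false → Kernel′ (x [ w ]≔ true) ⇔ (ColSol x × w-entry x ≡ false)
  kernel′⇔colSol x xw = mk⇔ to from
    where
    x′ : Vec Bool n
    x′ = x [ w ]≔ true
    Kx′ : ∀ i → (K *ᵥ x′) i ≡ (K *ᵥ x) i xor K i w
    Kx′ = *ᵥ-update K x w xw
    to : Kernel′ x′ → ColSol x × w-entry x ≡ false
    to s = solves supp (λ i Wi → xor-false⇒≡ (trans (sym (Kx′ i)) (satisfied s i (∈W⇒∈W′ i Wi)))) , Kxʷ≡0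
      where
      supp : ∀ i → lookup x i ≡ true → lookup W i ≡ true
      supp i xi with i ≟ w
      ... | yes refl = contradiction (trans (sym xi) xw) true≢false
      ... | no i≢w   = ∈W′⇒∈W i i≢w (supported s i (trans (lookup∘update′ i≢w x true) xi))
      Kxʷ≡0 : w-entry x ≡ false
      Kxʷ≡0 = begin
        w-entry x                    ≡⟨ xor-identityʳ (w-entry x) ⟨
        w-entry x xor false          ≡⟨ cong (w-entry x xor_) (proj₂ K-simple w) ⟨
        w-entry x xor K w w          ≡⟨ Kx′ w ⟨
        (K *ᵥ x′) w            ≡⟨ satisfied s w w∈W′ ⟩
        false                  ∎
    from : ColSol x × w-entry x ≡ false → Kernel′ x′
    from (s , Kxʷ≡0) = solves supp sat
      where
      supp : ∀ i → lookup x′ i ≡ true → lookup W′ i ≡ true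
      supp i x′i with i ≟ w
      ... | yes refl = w∈W′
      ... | no i≢w   = ∈W⇒∈W′ i (supported s i (trans (sym (lookup∘update′ i≢w x true)) x′i))
      sat : ∀ i → lookup W′ i ≡ true → (K *ᵥ x′) i ≡ false
      sat i W′i with i ≟ w
      ... | yes refl = trans (Kx′ w) (cong₂ _xor_ Kxʷ≡0 (proj₂ K-simple w))
      ... | no i≢w   =
        trans (Kx′ i) (trans (cong (_xor K i w) (satisfied s i (∈W′⇒∈W i i≢w W′i))) (xor-same (K i w)))

  kernelSize-W′-split : kernelSize K W′ ≡ count (kernel? with-w-entry≡ false)
                                   ℕ.+ count (colSol? with-w-entry≡ false)
  kernelSize-W′-split =
    trans (ℕΣ.cubeSum-pairs n _ w) (trans (ℕΣ.cubeSum-cong n pointwise) (ℕΣ.cubeSum-distrib-+ n _ _))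
    where
    pointwise : ∀ x → (if lookup x w then 0 else 𝟙 (does (kernel′? x)) ℕ.+ 𝟙 (does (kernel′? (x [ w ]≔ true))))
                    ≡ 𝟙 (does ((kernel? with-w-entry≡ false) x)) ℕ.+ 𝟙 (does ((colSol? with-w-entry≡ false) x))
    pointwise x with lookup x w in xw
    ... | true  = sym (cong₂ ℕ._+_ (cong 𝟙 (dec-false ((kernel? with-w-entry≡ false) x) (outside ∘ proj₁)))
                                 (cong 𝟙 (dec-false ((colSol? with-w-entry≡ false) x) (outside ∘ proj₁))))
      where
      outside : ∀ {c} → ¬ Solves K W c x
      outside = solves-outside w xw w∉W
    ... | false = cong₂ ℕ._+_
      (cong 𝟙 (does-⇔ (kernel′⇔kernel x xw) (kernel′? x) ((kernel? with-w-entry≡ false) x)))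
      (cong 𝟙 (does-⇔ (kernel′⇔colSol x xw) (kernel′? (x [ w ]≔ true)) ((colSol? with-w-entry≡ false) x)))

  w-entry≡column· : ∀ y → w-entry y ≡ column K w · lookup y
  w-entry≡column· y = ·-congʳ (lookup y) (λ j _ → K-sym w j)

  kernel⊥column : ∀ {x₀ y} → ColSol x₀ → Kernel y → w-entry y ≡ false
  kernel⊥column {x₀} {y} x₀-sol y-ker = begin
    w-entry y                      ≡⟨ w-entry≡column· y ⟩
    column K w · lookup y    ≡⟨ ·-congʳ (lookup y) (λ j yj → sym (satisfied x₀-sol j (supported y-ker j yj))) ⟩
    (K *ᵥ x₀) · lookup y     ≡⟨ *ᵥ-symmetric K-sym x₀ y ⟩
    (K *ᵥ y) · lookup x₀     ≡⟨ ·-congʳ (lookup x₀) (λ j x₀j → satisfied y-ker j (supported x₀-sol j x₀j)) ⟩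
    (λ _ → false) · lookup x₀ ≡⟨ ·-zeroˡ (lookup x₀) ⟩
    false                    ∎

  column-isotropic : ∀ {x} → ColSol x → w-entry x ≡ false
  column-isotropic {x} x-sol = begin
    w-entry x                    ≡⟨ w-entry≡column· x ⟩
    column K w · lookup x  ≡⟨ ·-congʳ (lookup x) (λ j xj → sym (satisfied x-sol j (supported x-sol j xj))) ⟩
    (K *ᵥ x) · lookup x    ≡⟨ *ᵥ-alternating K-simple x ⟩
    false                  ∎

  kernelSize-double : ∀ {x₀} → ColSol x₀ → kernelSize K W′ ≡ 2 ℕ.* kernelSize K W
  kernelSize-double x₀-sol = begin
    kernelSize K W′
      ≡⟨ kernelSize-W′-split ⟩
    count (kernel? with-w-entry≡ false) ℕ.+ count (colSol? with-w-entry≡ false)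
      ≡⟨ cong₂ ℕ._+_
           (count-cong (kernel? with-w-entry≡ false) kernel? (λ _ → mk⇔ proj₁ (λ k → k , kernel⊥column x₀-sol k)))
           (count-cong (colSol? with-w-entry≡ false) colSol? (λ _ → mk⇔ proj₁ (λ s → s , column-isotropic s))) ⟩
    kernelSize K W ℕ.+ #solutions K W (column K w)
      ≡⟨ cong (kernelSize K W ℕ.+_) (#solutions≡kernelSize x₀-sol) ⟩
    kernelSize K W ℕ.+ kernelSize K W
      ≡⟨ double (kernelSize K W) ⟩
    2 ℕ.* kernelSize K W ∎

  kernelSize-halve : ∀ {y₀} → Kernel y₀ → w-entry y₀ ≡ true → (∀ x → ¬ ColSol x) →
                     kernelSize K W ≡ 2 ℕ.* kernelSize K W′
  kernelSize-halve {y₀} y₀-ker Ky₀ʷ≡1 no-sol = begin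
    kernelSize K W
      ≡⟨ count-split kernel? w-entry ⟩
    A ℕ.+ count (kernel? with-w-entry≡ true)
      ≡⟨ cong (A ℕ.+_) (count-translate (kernel? with-w-entry≡ true) (kernel? with-w-entry≡ false) y₀ translate) ⟩
    A ℕ.+ A
      ≡⟨ cong (λ a → a ℕ.+ a) κ′≡A ⟨
    kernelSize K W′ ℕ.+ kernelSize K W′
      ≡⟨ double (kernelSize K W′) ⟩
    2 ℕ.* kernelSize K W′ ∎
    where
    A : ℕ
    A = count (kernel? with-w-entry≡ false)
    κ′≡A : kernelSize K W′ ≡ A
    κ′≡A = trans kernelSize-W′-split
      (trans (cong (A ℕ.+_) (count-empty (colSol? with-w-entry≡ false) (λ x → no-sol x ∘ proj₁))) (ℕ.+-identityʳ A))
    w-entry-⊕ : ∀ x → w-entry (x ⊕ y₀) ≡ not (w-entry x)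
    w-entry-⊕ x = begin
      w-entry (x ⊕ y₀)              ≡⟨ *ᵥ-⊕ K x y₀ w ⟩
      w-entry x xor w-entry y₀      ≡⟨ cong (w-entry x xor_) Ky₀ʷ≡1 ⟩
      w-entry x xor true            ≡⟨ xor-comm (w-entry x) true ⟩
      not (w-entry x)               ∎
    translate : ∀ x → (Kernel (x ⊕ y₀) × w-entry (x ⊕ y₀) ≡ true) ⇔ (Kernel x × w-entry x ≡ false)
    translate x = mk⇔
      (λ (k , e) → Equivalence.to   (solves-translate y₀-ker (λ _ → refl) x) k , not-injective (trans (sym (w-entry-⊕ x)) e))
      (λ (k , e) → Equivalence.from (solves-translate y₀-ker (λ _ → refl) x) k , trans (w-entry-⊕ x) (cong not e))

  private
    masked : Matrix n n
    masked i j = (lookup W i ∧ lookup W j) ∧ K i j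

    maskedColumn : Fin n → Bool
    maskedColumn i = lookup W i ∧ K i w

    restrict : Vec Bool n → Vec Bool n
    restrict x = zipWith _∧_ x W

    lookup-restrict : ∀ x j → lookup (restrict x) j ≡ lookup x j ∧ lookup W j
    lookup-restrict x j = lookup-zipWith _∧_ j x W

    restrict-supported : ∀ x i → lookup (restrict x) i ≡ true → lookup W i ≡ true
    restrict-supported x i h = ∧-conicalʳ (lookup x i) (lookup W i) (trans (sym (lookup-restrict x i)) h)

  colSol-from-solution : Solution masked maskedColumn → ∃ ColSol
  colSol-from-solution (x , Mx≡b) = restrict x , solves (restrict-supported x) sat
    where
    sat : ∀ i → lookup W i ≡ true → (K *ᵥ restrict x) i ≡ K i w
    sat i Wi = begin
      K i · lookup (restrict x)      ≡⟨ sum-cong-≗ (λ j → trans (cong (K i j ∧_) (lookup-restrict x j)) (reorder j)) ⟩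
      masked i · lookup x            ≡⟨ Mx≡b i ⟩
      lookup W i ∧ K i w             ≡⟨ cong (_∧ K i w) Wi ⟩
      K i w                          ∎
      where
      reorder : ∀ j → K i j ∧ (lookup x j ∧ lookup W j) ≡ masked i j ∧ lookup x j
      reorder j rewrite Wi = solve 3 (λ k a v → k :* (a :* v) := (v :* k) :* a) refl (K i j) (lookup x j) (lookup W j)

  kernel-from-obstruction : Obstruction masked maskedColumn → Σ[ y₀ ∈ Vec Bool n ] Kernel y₀ × w-entry y₀ ≡ true
  kernel-from-obstruction (y , yM≡0 , yb≡1) = restrict y , solves (restrict-supported y) sat , Kyʷ≡1
    where
    sat : ∀ j → lookup W j ≡ true → (K *ᵥ restrict y) j ≡ false
    sat j Wj = trans (sum-cong-≗ reorder) (yM≡0 j)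
      where
      reorder : ∀ i → K j i ∧ lookup (restrict y) i ≡ lookup y i ∧ masked i j
      reorder i rewrite lookup-restrict y i | K-sym j i | Wj =
        solve 3 (λ k a v → k :* (a :* v) := a :* ((v :* con true) :* k)) refl (K i j) (lookup y i) (lookup W i)
    Kyʷ≡1 : w-entry (restrict y) ≡ true
    Kyʷ≡1 = trans (sum-cong-≗ reorder) yb≡1
      where
      reorder : ∀ i → K w i ∧ lookup (restrict y) i ≡ lookup y i ∧ maskedColumn i
      reorder i rewrite lookup-restrict y i | K-sym w i =
        solve 3 (λ k a v → k :* (a :* v) := a :* (v :* k)) refl (K i w) (lookup y i) (lookup W i)

  kernelSize-insert-consistent : consistent K W w ≡ true → kernelSize K W′ ≡ 2 ℕ.* kernelSize K W
  kernelSize-insert-consistent consistent≡1 = kernelSize-double (proj₂ (positive-count⇒∃ colSol? consistent≡1))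

  kernelSize-insert-inconsistent : consistent K W w ≡ false → kernelSize K W ≡ 2 ℕ.* kernelSize K W′
  kernelSize-insert-inconsistent consistent≡0 with fredholm n masked maskedColumn
  ... | inj₁ sol = let (x , x-sol) = colSol-from-solution sol in
                   contradiction x-sol (¬positive-count⇒∄ colSol? consistent≡0 x)
  ... | inj₂ obs = let (_ , y₀-ker , Ky₀ʷ≡1) = kernel-from-obstruction obs in
                   kernelSize-halve y₀-ker Ky₀ʷ≡1 (¬positive-count⇒∄ colSol? consistent≡0)

tailGraph : ∀ {n} → Graph (suc n) → Graph n
tailGraph K i j = K (suc i) (suc j)

tailGraph-simple : ∀ {n} {K : Graph (suc n)} → IsSimple K → IsSimple (tailGraph K)
tailGraph-simple (K-sym , K-loopless) = (λ i j → K-sym (suc i) (suc j)) , K-loopless ∘ suc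

kernelSize-tail : ∀ {n} (K : Graph (suc n)) W → kernelSize K (false ∷ W) ≡ kernelSize (tailGraph K) W
kernelSize-tail {n} K W = begin
  count (kernel? ∘ (false ∷_)) ℕ.+ count (kernel? ∘ (true ∷_))
    ≡⟨ cong₂ ℕ._+_ (count-cong (kernel? ∘ (false ∷_)) tail-kernel? tail⇔) (count-empty (kernel? ∘ (true ∷_)) ∉W) ⟩
  kernelSize (tailGraph K) W ℕ.+ 0
    ≡⟨ ℕ.+-identityʳ _ ⟩
  kernelSize (tailGraph K) W ∎
  where
  kernel? : Decidable (Solves K (false ∷ W) (λ _ → false))
  kernel? = solves? K (false ∷ W) (λ _ → false)
  tail-kernel? : Decidable (Solves (tailGraph K) W (λ _ → false))
  tail-kernel? = solves? (tailGraph K) W (λ _ → false)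
  ∉W : ∀ x → ¬ Solves K (false ∷ W) (λ _ → false) (true ∷ x)
  ∉W x = solves-outside zero refl refl
  Kx≡ : ∀ x i → (K *ᵥ (false ∷ x)) (suc i) ≡ (tailGraph K *ᵥ x) i
  Kx≡ x i = cong (_xor (tailGraph K *ᵥ x) i) (∧-zeroʳ (K (suc i) zero))
  tail⇔ : ∀ x → Solves K (false ∷ W) (λ _ → false) (false ∷ x) ⇔ Solves (tailGraph K) W (λ _ → false) x
  tail⇔ x = mk⇔
    (λ s → solves (supported s ∘ suc) (λ i Wi → trans (sym (Kx≡ x i)) (satisfied s (suc i) Wi)))
    (λ s → solves (λ { zero () ; (suc i) → supported s i })
                  (λ { zero () ; (suc i) Wi → trans (Kx≡ x i) (satisfied s i Wi) }))

half-of-power-of-two : ∀ d m → 2 ^ d ≡ 2 ℕ.* m → ∃[ d′ ] m ≡ 2 ^ d′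
half-of-power-of-two zero    m 1≡2m = contradiction (ℕ.m*n≡1⇒m≡1 2 m (sym 1≡2m)) (λ ())
half-of-power-of-two (suc d) m eq   = d , ℕ.*-cancelˡ-≡ m (2 ^ d) 2 (sym eq)

kernelSize-power-of-two : ∀ {n} {K : Graph n} → IsSimple K → ∀ W → ∃[ d ] kernelSize K W ≡ 2 ^ d
kernelSize-power-of-two K-simple [] = 0 , refl
kernelSize-power-of-two {K = K} K-simple (false ∷ W) =
  let (d , κ≡2^d) = kernelSize-power-of-two (tailGraph-simple K-simple) W in d , trans (kernelSize-tail K W) κ≡2^d
kernelSize-power-of-two {K = K} K-simple (true ∷ W)
  with kernelSize-power-of-two (tailGraph-simple K-simple) W | consistent K (false ∷ W) zero in c
... | d , κ≡2^d | true  = suc d , trans (kernelSize-insert-consistent c) (cong (2 ℕ.*_) κ₀≡2^d)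
  where
  open Insertion K-simple {false ∷ W} {zero} refl
  κ₀≡2^d : kernelSize K (false ∷ W) ≡ 2 ^ d
  κ₀≡2^d = trans (kernelSize-tail K W) κ≡2^d
... | d , κ≡2^d | false = half-of-power-of-two d _ (trans (sym κ₀≡2^d) (kernelSize-insert-inconsistent c))
  where
  open Insertion K-simple {false ∷ W} {zero} refl
  κ₀≡2^d : kernelSize K (false ∷ W) ≡ 2 ^ d
  κ₀≡2^d = trans (kernelSize-tail K W) κ≡2^d

kernelDim : ∀ {n} → Graph n → Subset n → ℕ
kernelDim K W = ⌊log₂ kernelSize K W ⌋

kernelDim-power-of-two : ∀ {n} (K : Graph n) W {d} → kernelSize K W ≡ 2 ^ d → kernelDim K W ≡ d
kernelDim-power-of-two K W {d} κ≡2^d = trans (cong ⌊log₂_⌋ κ≡2^d) (⌊log₂[2^n]⌋≡n d)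

kernelDim-double : ∀ {n} {K : Graph n} → IsSimple K → ∀ {W W′} →
             kernelSize K W′ ≡ 2 ℕ.* kernelSize K W → kernelDim K W′ ≡ suc (kernelDim K W)
kernelDim-double {K = K} K-simple {W} {W′} κ′≡2κ =
  let (d , κ≡2^d) = kernelSize-power-of-two K-simple W in
  trans (kernelDim-power-of-two K W′ {suc d} (trans κ′≡2κ (cong (2 ℕ.*_) κ≡2^d)))
        (cong suc (sym (kernelDim-power-of-two K W κ≡2^d)))

module _ {n} {K : Graph n} (K-simple : IsSimple K) {W : Subset n} {w : Fin n} (w∉W : lookup W w ≡ false) where
  open Insertion K-simple {W} {w} w∉W using (kernelSize-insert-consistent; kernelSize-insert-inconsistent)

  kernelDim-insert-consistent : consistent K W w ≡ true → kernelDim K (W [ w ]≔ true) ≡ suc (kernelDim K W)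
  kernelDim-insert-consistent c = kernelDim-double K-simple {W} {W [ w ]≔ true} (kernelSize-insert-consistent c)

  kernelDim-insert-inconsistent : consistent K W w ≡ false → kernelDim K W ≡ suc (kernelDim K (W [ w ]≔ true))
  kernelDim-insert-inconsistent c = kernelDim-double K-simple {W [ w ]≔ true} {W} (kernelSize-insert-inconsistent c)

-- The nullity of an induced subgraph

length-filter≡listSum : ∀ {A : Set} (p : A → Bool) xs →
  length (filter (λ x → p x Bool.≟ true) xs) ≡ ℕΣ.listSum (List.map (𝟙 ∘ p) xs)
length-filter≡listSum p List.[] = refl
length-filter≡listSum p (x List.∷ xs) with p x
... | true  = cong suc (length-filter≡listSum p xs)
... | false = length-filter≡listSum p xs

allB⇔ : ∀ p {f : Fin p → Bool} → allB p f ≡ true ⇔ (∀ i → f i ≡ true)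
allB⇔ zero    = mk⇔ (λ _ ()) (λ _ → refl)
allB⇔ (suc p) {f} with f zero in f₀
... | true  = mk⇔ (λ { h zero → f₀ ; h (suc i) → Equivalence.to (allB⇔ p) h i })
                  (λ h → Equivalence.from (allB⇔ p) (h ∘ suc))
... | false = mk⇔ (λ ()) (λ h → trans (sym f₀) (h zero))

memberVec : ∀ {n} (W : Subset n) → Vec (Fin n) (∣ W ∣)
memberVec []          = []
memberVec (true ∷ W)  = zero ∷ map suc (memberVec W)
memberVec (false ∷ W) = map suc (memberVec W)

members≡toList : ∀ {n} (W : Subset n) → members W ≡ toList (memberVec W)
members-suc≡toList : ∀ {n} (W : Subset n) → List.map suc (members W) ≡ toList (map suc (memberVec W))

members-suc≡toList W = trans (cong (List.map suc) (members≡toList W)) (sym (toList-map suc (memberVec W)))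

members≡toList []          = refl
members≡toList (true ∷ W)  = cong (zero List.∷_) (members-suc≡toList W)
members≡toList (false ∷ W) = members-suc≡toList W

scatter : ∀ {n} (W : Subset n) → Vec Bool (∣ W ∣) → Vec Bool n
scatter []          []      = []
scatter (true ∷ W)  (b ∷ z) = b ∷ scatter W z
scatter (false ∷ W) z       = false ∷ scatter W z

scatter-⊆ : ∀ {n} (W : Subset n) z → scatter W z ⊆ W
scatter-⊆ (true ∷ W)  (b ∷ z) zero    _ = refl
scatter-⊆ (true ∷ W)  (b ∷ z) (suc i) h = scatter-⊆ W z i h
scatter-⊆ (false ∷ W) z       (suc i) h = scatter-⊆ W z i h

·-scatter : ∀ {n} (W : Subset n) (g : Fin n → Bool) z →
            (g ∘ lookup (memberVec W)) · lookup z ≡ g · lookup (scatter W z)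
·-scatter []          g []      = refl
·-scatter (true ∷ W)  g (b ∷ z) = cong ((g zero ∧ b) xor_)
  (trans (·-congʳ (lookup z) (λ s _ → cong g (lookup-map s suc (memberVec W)))) (·-scatter W (g ∘ suc) z))
·-scatter (false ∷ W) g z       = trans
  (trans (·-congʳ (lookup z) (λ s _ → cong g (lookup-map s suc (memberVec W)))) (·-scatter W (g ∘ suc) z))
  (cong (_xor (g ∘ suc) · lookup (scatter W z)) (sym (∧-zeroʳ (g zero))))

all-map-suc⇔ : ∀ {n k} (v : Vec (Fin n) k) (P : Fin (suc n) → Set) →
               (∀ s → P (lookup (map suc v) s)) ⇔ (∀ s → P (suc (lookup v s)))
all-map-suc⇔ v P = mk⇔ (λ h s → subst P (lookup-map s suc v) (h s)) (λ h s → subst P (sym (lookup-map s suc v)) (h s))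

all-members⇔ : ∀ {n} (W : Subset n) (P : Fin n → Set) →
               (∀ s → P (lookup (memberVec W) s)) ⇔ (∀ i → lookup W i ≡ true → P i)
all-suc-members⇔ : ∀ {n} (W : Subset n) (P : Fin (suc n) → Set) →
                   (∀ s → P (lookup (map suc (memberVec W)) s)) ⇔ (∀ i → lookup W i ≡ true → P (suc i))

all-suc-members⇔ W P = all-members⇔ W (P ∘ suc) ⇔-∘ all-map-suc⇔ (memberVec W) P

all-members⇔ []          P = mk⇔ (λ _ ()) (λ _ ())
all-members⇔ (true ∷ W)  P = mk⇔
  (λ h → λ { zero _ → h zero ; (suc i) → Equivalence.to (all-suc-members⇔ W P) (h ∘ suc) i })
  (λ h → λ { zero → h zero refl ; (suc s) → Equivalence.from (all-suc-members⇔ W P) (h ∘ suc) s })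
all-members⇔ (false ∷ W) P = mk⇔
  (λ h → λ { zero () ; (suc i) → Equivalence.to (all-suc-members⇔ W P) h i })
  (λ h → Equivalence.from (all-suc-members⇔ W P) (h ∘ suc))

cubeSum-scatter : ∀ {n} (W : Subset n) (f : Vec Bool n → ℕ) → (∀ x → ¬ x ⊆ W → f x ≡ 0) →
                  ℕΣ.cubeSum ∣ W ∣ (f ∘ scatter W) ≡ ℕΣ.cubeSum n f
cubeSum-scatter []          f _      = refl
cubeSum-scatter (true ∷ W)  f f-off = cong₂ ℕ._+_
  (cubeSum-scatter W (f ∘ (false ∷_)) (λ x x⊈W → f-off (false ∷ x) (λ h → x⊈W (h ∘ suc))))
  (cubeSum-scatter W (f ∘ (true ∷_))  (λ x x⊈W → f-off (true ∷ x)  (λ h → x⊈W (h ∘ suc))))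
cubeSum-scatter {suc n} (false ∷ W) f f-off = begin
  ℕΣ.cubeSum ∣ W ∣ (f ∘ (false ∷_) ∘ scatter W) ≡⟨ cubeSum-scatter W (f ∘ (false ∷_)) (λ x → f-off (false ∷ x) ∘ tail-⊈) ⟩
  ℕΣ.cubeSum n (f ∘ (false ∷_))                  ≡⟨ ℕ.+-identityʳ _ ⟨
  ℕΣ.cubeSum n (f ∘ (false ∷_)) ℕ.+ 0            ≡⟨ cong (ℕΣ.cubeSum n (f ∘ (false ∷_)) ℕ.+_) off-W ⟩
  ℕΣ.cubeSum (suc n) f                           ∎
  where
  tail-⊈ : ∀ {x} → ¬ x ⊆ W → ¬ (false ∷ x) ⊆ (false ∷ W)
  tail-⊈ x⊈W h = x⊈W (h ∘ suc)
  off-W : 0 ≡ ℕΣ.cubeSum n (f ∘ (true ∷_))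
  off-W = trans (sym (ℕΣ.cubeSum-zero n))
    (ℕΣ.cubeSum-cong n (λ x → sym (f-off (true ∷ x) (λ h → true≢false (sym (h zero refl))))))

xorSum-cong : ∀ p {f g : Fin p → Bool} → (∀ j → f j ≡ g j) → xorSum p f ≡ xorSum p g
xorSum-cong p {f} {g} f≗g = trans (xorSum≡sum p f) (trans (sum-cong-≗ f≗g) (sym (xorSum≡sum p g)))

allB-cong : ∀ p {f g : Fin p → Bool} → (∀ i → f i ≡ g i) → allB p f ≡ allB p g
allB-cong zero    f≗g = refl
allB-cong (suc p) f≗g = cong₂ _∧_ (f≗g zero) (allB-cong p (f≗g ∘ suc))

inKernel-cong : ∀ {p} {M M′ : Matrix p p} → (∀ i j → M i j ≡ M′ i j) → ∀ z → inKernel M z ≡ inKernel M′ z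
inKernel-cong {p} M≗M′ z =
  allB-cong p (λ i → cong (if_then false else true) (xorSum-cong p (λ j → cong (_∧ lookup z j) (M≗M′ i j))))

kernelCount : ∀ {p} → Matrix p p → ℕ
kernelCount {p} M = ℕΣ.cubeSum p (𝟙 ∘ inKernel M)

kernelCount-cast : ∀ {p p′} (eq : p ≡ p′) (M : Matrix p p) (M′ : Matrix p′ p′) →
                   (∀ i j → M i j ≡ M′ (cast eq i) (cast eq j)) → kernelCount M ≡ kernelCount M′
kernelCount-cast {p} refl M M′ M≡M′ = ℕΣ.cubeSum-cong p (cong 𝟙 ∘ inKernel-cong M≗M′)
  where
  M≗M′ : ∀ i j → M i j ≡ M′ i j
  M≗M′ i j = trans (M≡M′ i j) (cong₂ M′ (Fin.cast-is-id refl i) (Fin.cast-is-id refl j))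

lookup-toList : ∀ {A : Set} {k} (v : Vec A k) i → List.lookup (toList v) i ≡ lookup v (cast (length-toList v) i)
lookup-toList (a ∷ v) zero    = refl
lookup-toList (a ∷ v) (suc i) = lookup-toList v i

≡does : ∀ {P : Set} {b} → (b ≡ true ⇔ P) → (P? : Dec P) → b ≡ does P?
≡does {b = b} b⇔P P? = trans (sym (does-≟true b)) (does-⇔ b⇔P (b Bool.≟ true) P?)
  where
  does-≟true : ∀ b → does (b Bool.≟ true) ≡ b
  does-≟true true  = refl
  does-≟true false = refl

if-false-true : ∀ b → (if b then false else true) ≡ not b
if-false-true true  = refl
if-false-true false = refl

inKernel-members : ∀ {n} (K : Graph n) W z →
  inKernel (λ s t → K (lookup (memberVec W) s) (lookup (memberVec W) t)) z
    ≡ does (solves? K W (λ _ → false) (scatter W z))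
inKernel-members {n} K W z = ≡does (mk⇔ to from) (solves? K W (λ _ → false) x)
  where
  v : Vec (Fin n) ∣ W ∣
  v = memberVec W
  x : Vec Bool n
  x = scatter W z
  row : ∀ s → (if xorSum ∣ W ∣ (λ t → K (lookup v s) (lookup v t) ∧ lookup z t) then false else true)
              ≡ not ((K *ᵥ x) (lookup v s))
  row s = trans (if-false-true _) (cong not (begin
    xorSum ∣ W ∣ (λ t → K (lookup v s) (lookup v t) ∧ lookup z t) ≡⟨ xorSum≡sum ∣ W ∣ _ ⟩
    (K (lookup v s) ∘ lookup v) · lookup z                       ≡⟨ ·-scatter W (K (lookup v s)) z ⟩
    (K *ᵥ x) (lookup v s)                                        ∎))
  Kx≡0-on-W⇔ : (∀ s → (K *ᵥ x) (lookup v s) ≡ false) ⇔ (∀ i → lookup W i ≡ true → (K *ᵥ x) i ≡ false)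
  Kx≡0-on-W⇔ = all-members⇔ W (λ i → (K *ᵥ x) i ≡ false)
  to : inKernel (λ s t → K (lookup v s) (lookup v t)) z ≡ true → Solves K W (λ _ → false) x
  to h = solves (scatter-⊆ W z)
    (Equivalence.to Kx≡0-on-W⇔ (λ s → not-injective (trans (sym (row s)) (Equivalence.to (allB⇔ ∣ W ∣) h s))))
  from : Solves K W (λ _ → false) x → inKernel (λ s t → K (lookup v s) (lookup v t)) z ≡ true
  from x-ker = Equivalence.from (allB⇔ ∣ W ∣)
    (λ s → trans (row s) (cong not (Equivalence.from Kx≡0-on-W⇔ (satisfied x-ker) s)))

kernelCount-toList : ∀ {n} (K : Graph n) (L : List (Fin n)) {k} (v : Vec (Fin n) k) → L ≡ toList v →
  kernelCount (λ i j → K (List.lookup L i) (List.lookup L j)) ≡ kernelCount (λ s t → K (lookup v s) (lookup v t))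
kernelCount-toList K .(toList v) v refl =
  kernelCount-cast (length-toList v) _ _ (λ i j → cong₂ K (lookup-toList v i) (lookup-toList v j))

nullity-induced : ∀ {n} (K : Graph n) W → nullity (induced K W) ≡ kernelDim K W
nullity-induced {n} K W = cong ⌊log₂_⌋ (begin
  length (filter (λ z → inKernel (induced K W) z Bool.≟ true) (allVecs _))
    ≡⟨ length-filter≡listSum (inKernel (induced K W)) (allVecs _) ⟩
  ℕΣ.listSum (List.map (𝟙 ∘ inKernel (induced K W)) (allVecs _))
    ≡⟨ ℕΣ.listSum-allVecs (length (members W)) (𝟙 ∘ inKernel (induced K W)) ⟩
  kernelCount (induced K W)
    ≡⟨ kernelCount-toList K (members W) (memberVec W) (members≡toList W) ⟩
  kernelCount (λ s t → K (lookup (memberVec W) s) (lookup (memberVec W) t))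
    ≡⟨ ℕΣ.cubeSum-cong (∣ W ∣) (λ z → cong 𝟙 (inKernel-members K W z)) ⟩
  ℕΣ.cubeSum ∣ W ∣ (λ z → 𝟙 (does (solves? K W (λ _ → false) (scatter W z))))
    ≡⟨ cubeSum-scatter W _ (λ x x⊈W → cong 𝟙 (dec-false (solves? K W (λ _ → false) x) (x⊈W ∘ supported))) ⟩
  kernelSize K W ∎)

-- γ through a single vertex

module ℤΣ = CubeSum ℤ.+-*-isSemiring

signℤ-+ : ∀ d e → signℤ (d ℕ.+ e) ≡ signℤ d * signℤ e
signℤ-+ zero    e = sym (ℤ.*-identityˡ (signℤ e))
signℤ-+ (suc d) e = trans (cong -_ (signℤ-+ d e)) (ℤ.neg-distribˡ-* (signℤ d) (signℤ e))

signℤ-cancel : ∀ d → signℤ d + signℤ (suc d) ≡ + 0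
signℤ-cancel d = ℤ.+-inverseʳ (signℤ d)

linearCoeff : ℕ → ℤ
linearCoeff d = coeffPow d 1

linearCoeff-consecutive : ∀ d → linearCoeff d + linearCoeff (suc d) ≡ signℤ d
linearCoeff-consecutive zero    = refl
linearCoeff-consecutive (suc d) = begin
  linearCoeff (suc d) + linearCoeff (suc (suc d))
    ≡⟨ cong₂ (λ a b → signℤ d * + a + (- signℤ d) * + b) (nC1≡n (suc d)) (trans (nC1≡n (suc (suc d))) (ℕ.+-comm 1 (suc d))) ⟩
  signℤ d * + suc d + (- signℤ d) * (+ suc d + + 1)
    ≡⟨ identity (signℤ d) (+ suc d) ⟩
  - signℤ d ∎
  where
  identity : ∀ s a → s * a + (- s) * (a + + 1) ≡ - s
  identity = solve-∀

consistentSign : ∀ {n} → Graph n → Fin n → Subset n → ℤ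
consistentSign K w W = if lookup W w then + 0 else (if consistent K W w then signℤ (kernelDim K W) else + 0)

γ≡cubeSum : ∀ {n} (K : Graph n) → γ K ≡ ℤΣ.cubeSum n (linearCoeff ∘ kernelDim K)
γ≡cubeSum {n} K = trans (ℤΣ.listSum-allVecs n (λ W → coeffPow (nullity (induced K W)) 1))
                        (ℤΣ.cubeSum-cong n (λ W → cong linearCoeff (nullity-induced K W)))

module _ {n} {K : Graph n} (K-simple : IsSimple K) where

  signs-cancel : ∀ {W w} → lookup W w ≡ false → signℤ (kernelDim K W) + signℤ (kernelDim K (W [ w ]≔ true)) ≡ + 0
  signs-cancel {W} {w} w∉W with consistent K W w in c
  ... | true  = begin
    signℤ (kernelDim K W) + signℤ (kernelDim K (W [ w ]≔ true))
      ≡⟨ cong (λ e → signℤ (kernelDim K W) + signℤ e) dim′≡ ⟩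
    signℤ (kernelDim K W) + signℤ (suc (kernelDim K W))
      ≡⟨ signℤ-cancel (kernelDim K W) ⟩
    + 0 ∎
    where
    dim′≡ : kernelDim K (W [ w ]≔ true) ≡ suc (kernelDim K W)
    dim′≡ = kernelDim-insert-consistent K-simple {W} {w} w∉W c
  ... | false = begin
    signℤ (kernelDim K W) + signℤ d′ ≡⟨ cong (λ e → signℤ e + signℤ d′) dim≡ ⟩
    signℤ (suc d′) + signℤ d′        ≡⟨ ℤ.+-comm (signℤ (suc d′)) (signℤ d′) ⟩
    signℤ d′ + signℤ (suc d′)        ≡⟨ signℤ-cancel d′ ⟩
    + 0                              ∎
    where
    d′ : ℕ
    d′ = kernelDim K (W [ w ]≔ true)
    dim≡ : kernelDim K W ≡ suc d′
    dim≡ = kernelDim-insert-inconsistent K-simple {W} {w} w∉W c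

  linearCoeffs-pair : ∀ {W w} → lookup W w ≡ false →
    linearCoeff (kernelDim K W) + linearCoeff (kernelDim K (W [ w ]≔ true))
      ≡ + 2 * (if consistent K W w then signℤ (kernelDim K W) else + 0) + -1ℤ * signℤ (kernelDim K W)
  linearCoeffs-pair {W} {w} w∉W with consistent K W w in c
  ... | true  = begin
    linearCoeff d + linearCoeff (kernelDim K (W [ w ]≔ true)) ≡⟨ cong (λ e → linearCoeff d + linearCoeff e) dim′≡ ⟩
    linearCoeff d + linearCoeff (suc d)                       ≡⟨ linearCoeff-consecutive d ⟩
    signℤ d                                                   ≡⟨ identity (signℤ d) ⟩
    + 2 * signℤ d + -1ℤ * signℤ d                             ∎
    where
    d : ℕ
    d = kernelDim K W
    dim′≡ : kernelDim K (W [ w ]≔ true) ≡ suc d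
    dim′≡ = kernelDim-insert-consistent K-simple {W} {w} w∉W c
    identity : ∀ s → s ≡ + 2 * s + -1ℤ * s
    identity = solve-∀
  ... | false = begin
    linearCoeff (kernelDim K W) + linearCoeff d′ ≡⟨ cong (λ e → linearCoeff e + linearCoeff d′) dim≡ ⟩
    linearCoeff (suc d′) + linearCoeff d′        ≡⟨ ℤ.+-comm (linearCoeff (suc d′)) (linearCoeff d′) ⟩
    linearCoeff d′ + linearCoeff (suc d′)        ≡⟨ linearCoeff-consecutive d′ ⟩
    signℤ d′                                     ≡⟨ identity (signℤ d′) ⟩
    + 2 * + 0 + -1ℤ * signℤ (suc d′)             ≡⟨ cong (λ e → + 2 * + 0 + -1ℤ * signℤ e) dim≡ ⟨
    + 2 * + 0 + -1ℤ * signℤ (kernelDim K W)      ∎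
    where
    d′ : ℕ
    d′ = kernelDim K (W [ w ]≔ true)
    dim≡ : kernelDim K W ≡ suc d′
    dim≡ = kernelDim-insert-inconsistent K-simple {W} {w} w∉W c
    identity : ∀ s → s ≡ + 2 * + 0 + -1ℤ * (- s)
    identity = solve-∀

  ∑signs≡0 : ∀ {w w′} → w′ ≢ w → ℤΣ.cubeSum n (λ W → if lookup W w then + 0 else signℤ (kernelDim K W)) ≡ + 0
  ∑signs≡0 {w} {w′} w′≢w = begin
    ℤΣ.cubeSum n signs                                                                 ≡⟨ ℤΣ.cubeSum-pairs n signs w′ ⟩
    ℤΣ.cubeSum n (λ W → if lookup W w′ then + 0 else signs W + signs (W [ w′ ]≔ true)) ≡⟨ ℤΣ.cubeSum-cong n pair ⟩
    ℤΣ.cubeSum n (λ _ → + 0)                                                           ≡⟨ ℤΣ.cubeSum-zero n ⟩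
    + 0                                                                                ∎
    where
    signs : Subset n → ℤ
    signs W = if lookup W w then + 0 else signℤ (kernelDim K W)
    pair : ∀ W → (if lookup W w′ then + 0 else signs W + signs (W [ w′ ]≔ true)) ≡ + 0
    pair W with lookup W w′ in w′∉W
    ... | true  = refl
    ... | false rewrite lookup∘update′ (w′≢w ∘ sym) W true with lookup W w
    ...   | true  = refl
    ...   | false = signs-cancel {W} {w′} w′∉W

  γ≡2*∑consistentSign : ∀ {w w′} → w′ ≢ w → γ K ≡ + 2 * ℤΣ.cubeSum n (consistentSign K w)
  γ≡2*∑consistentSign {w} {w′} w′≢w = begin
    γ K
      ≡⟨ γ≡cubeSum K ⟩
    ℤΣ.cubeSum n (linearCoeff ∘ kernelDim K)
      ≡⟨ ℤΣ.cubeSum-pairs n _ w ⟩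
    ℤΣ.cubeSum n (λ W → if lookup W w then + 0 else linearCoeff (kernelDim K W) + linearCoeff (kernelDim K (W [ w ]≔ true)))
      ≡⟨ ℤΣ.cubeSum-cong n pair ⟩
    ℤΣ.cubeSum n (λ W → + 2 * consistentSign K w W + -1ℤ * signs W)
      ≡⟨ ℤΣ.cubeSum-distrib-+ n _ _ ⟩
    ℤΣ.cubeSum n (λ W → + 2 * consistentSign K w W) + ℤΣ.cubeSum n (λ W → -1ℤ * signs W)
      ≡⟨ cong₂ _+_ (ℤΣ.*-distribˡ-cubeSum n (+ 2) _) (ℤΣ.*-distribˡ-cubeSum n -1ℤ signs) ⟩
    + 2 * ℤΣ.cubeSum n (consistentSign K w) + -1ℤ * ℤΣ.cubeSum n signs
      ≡⟨ cong (λ t → + 2 * ℤΣ.cubeSum n (consistentSign K w) + -1ℤ * t) (∑signs≡0 w′≢w) ⟩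
    + 2 * ℤΣ.cubeSum n (consistentSign K w) + -1ℤ * + 0
      ≡⟨ ℤ.+-identityʳ _ ⟩
    + 2 * ℤΣ.cubeSum n (consistentSign K w) ∎
    where
    signs : Subset n → ℤ
    signs W = if lookup W w then + 0 else signℤ (kernelDim K W)
    pair : ∀ W → (if lookup W w then + 0 else linearCoeff (kernelDim K W) + linearCoeff (kernelDim K (W [ w ]≔ true)))
               ≡ + 2 * consistentSign K w W + -1ℤ * signs W
    pair W with lookup W w in w∉W
    ... | true  = refl
    ... | false = linearCoeffs-pair {W} {w} w∉W

-- The one point join

data Split {m k} : Fin (m ℕ.+ k) → Set where
  left  : ∀ i → Split (i ↑ˡ k)
  right : ∀ j → Split (m ↑ʳ j)

split : ∀ {m k} (a : Fin (m ℕ.+ k)) → Split a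
split {m} {k} a with splitAt m a in eq
... | inj₁ i = subst Split (Fin.splitAt⁻¹-↑ˡ eq) (left i)
... | inj₂ j = subst Split (Fin.splitAt⁻¹-↑ʳ eq) (right j)

data Punched {k} (v : Fin (suc k)) : Fin (suc k) → Set where
  at    : Punched v v
  other : ∀ j → Punched v (punchIn v j)

punched : ∀ {k} (v a : Fin (suc k)) → Punched v a
punched v a with a ≟ v
... | yes refl = at
... | no a≢v = subst (Punched v) (Fin.punchIn-punchOut (a≢v ∘ sym)) (other (punchOut (a≢v ∘ sym)))

⌊≟⌋-refl : ∀ {n} (i : Fin n) → ⌊ i ≟ i ⌋ ≡ true
⌊≟⌋-refl i with i ≟ i
... | yes _   = refl
... | no i≢i = contradiction refl i≢i

⌊≟⌋-≢ : ∀ {n} {i j : Fin n} → i ≢ j → ⌊ i ≟ j ⌋ ≡ false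
⌊≟⌋-≢ {i = i} {j} i≢j with i ≟ j
... | yes i≡j = contradiction i≡j i≢j
... | no _    = refl

module OnePointJoin {m k} (G : Graph m) (F : Graph (suc k)) (u : Fin m) (v : Fin (suc k)) where

  H : Graph (m ℕ.+ k)
  H = onePointJoin G F u v

  H-GG : ∀ i j → H (i ↑ˡ k) (j ↑ˡ k) ≡ G i j
  H-GG i j rewrite Fin.splitAt-↑ˡ m i k | Fin.splitAt-↑ˡ m j k = refl

  H-GF : ∀ i j → H (i ↑ˡ k) (m ↑ʳ j) ≡ (if ⌊ i ≟ u ⌋ then F v (punchIn v j) else false)
  H-GF i j rewrite Fin.splitAt-↑ˡ m i k | Fin.splitAt-↑ʳ m k j = refl

  H-FG : ∀ i j → H (m ↑ʳ i) (j ↑ˡ k) ≡ (if ⌊ j ≟ u ⌋ then F (punchIn v i) v else false)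
  H-FG i j rewrite Fin.splitAt-↑ʳ m k i | Fin.splitAt-↑ˡ m j k = refl

  H-FF : ∀ i j → H (m ↑ʳ i) (m ↑ʳ j) ≡ F (punchIn v i) (punchIn v j)
  H-FF i j rewrite Fin.splitAt-↑ʳ m k i | Fin.splitAt-↑ʳ m k j = refl

  H-FG-u : ∀ j → H (m ↑ʳ j) (u ↑ˡ k) ≡ F (punchIn v j) v
  H-FG-u j = trans (H-FG j u) (cong (if_then F (punchIn v j) v else false) (⌊≟⌋-refl u))

  join-simple : IsSimple G → IsSimple F → IsSimple H
  join-simple (G-sym , G-loopless) (F-sym , F-loopless) = H-sym , H-loopless
    where
    H-sym : ∀ a b → H a b ≡ H b a
    H-sym a b with split {m} {k} a | split {m} {k} b
    ... | left i  | left j  = trans (H-GG i j) (trans (G-sym i j) (sym (H-GG j i)))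
    ... | left i  | right j =
      trans (H-GF i j) (trans (cong (if ⌊ i ≟ u ⌋ then_else false) (F-sym v (punchIn v j))) (sym (H-FG j i)))
    ... | right i | left j  =
      trans (H-FG i j) (trans (cong (if ⌊ j ≟ u ⌋ then_else false) (F-sym (punchIn v i) v)) (sym (H-GF j i)))
    ... | right i | right j = trans (H-FF i j) (trans (F-sym _ _) (sym (H-FF j i)))
    H-loopless : ∀ a → H a a ≡ false
    H-loopless a with split {m} {k} a
    ... | left i  = trans (H-GG i i) (G-loopless i)
    ... | right j = trans (H-FF j j) (F-loopless (punchIn v j))

  lift : Vec Bool k → Vec Bool (suc k)
  lift y = insertAt y v false

  *ᵥ-left : ∀ x y i → i ≢ u → (H *ᵥ (x ++ y)) (i ↑ˡ k) ≡ (G *ᵥ x) i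
  *ᵥ-left x y i i≢u = begin
    (H *ᵥ (x ++ y)) (i ↑ˡ k)
      ≡⟨ sum-↑ m k _ ⟩
    sum (λ j → H (i ↑ˡ k) (j ↑ˡ k) ∧ lookup (x ++ y) (j ↑ˡ k)) xor sum (λ j → H (i ↑ˡ k) (m ↑ʳ j) ∧ lookup (x ++ y) (m ↑ʳ j))
      ≡⟨ cong₂ _xor_ (sum-cong-≗ (λ j → cong₂ _∧_ (H-GG i j) (lookup-++ˡ x y j)))
                     (trans (sum-cong-≗ (λ j → cong (_∧ lookup (x ++ y) (m ↑ʳ j)) off-u)) (sum-replicate-zero k)) ⟩
    (G *ᵥ x) i xor false
      ≡⟨ xor-identityʳ _ ⟩
    (G *ᵥ x) i ∎
    where
    off-u : ∀ {j} → H (i ↑ˡ k) (m ↑ʳ j) ≡ false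
    off-u {j} = trans (H-GF i j) (cong (if_then F v (punchIn v j) else false) (⌊≟⌋-≢ i≢u))

  *ᵥ-right : ∀ x y j → lookup x u ≡ false → (H *ᵥ (x ++ y)) (m ↑ʳ j) ≡ (F *ᵥ lift y) (punchIn v j)
  *ᵥ-right x y j xu≡0 = begin
    (H *ᵥ (x ++ y)) (m ↑ʳ j)
      ≡⟨ sum-↑ m k _ ⟩
    sum (λ i → H (m ↑ʳ j) (i ↑ˡ k) ∧ lookup (x ++ y) (i ↑ˡ k)) xor sum (λ l → H (m ↑ʳ j) (m ↑ʳ l) ∧ lookup (x ++ y) (m ↑ʳ l))
      ≡⟨ cong₂ _xor_ (trans (sum-cong-≗ G-part) (sum-replicate-zero m))
                     (sum-cong-≗ (λ l → cong₂ _∧_ (H-FF j l) (trans (lookup-++ʳ x y l) (sym (insertAt-punchIn y v false l))))) ⟩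
    false xor sum (λ l → F (punchIn v j) (punchIn v l) ∧ lookup (lift y) (punchIn v l))
      ≡⟨ cong (_xor sum (λ l → F (punchIn v j) (punchIn v l) ∧ lookup (lift y) (punchIn v l)))
              (trans (sym (∧-zeroʳ (F (punchIn v j) v))) (cong (F (punchIn v j) v ∧_) (sym (insertAt-lookup y v false)))) ⟩
    (F (punchIn v j) v ∧ lookup (lift y) v) xor sum (λ l → F (punchIn v j) (punchIn v l) ∧ lookup (lift y) (punchIn v l))
      ≡⟨ sum-remove {i = v} (λ a → F (punchIn v j) a ∧ lookup (lift y) a) ⟨
    (F *ᵥ lift y) (punchIn v j) ∎
    where
    G-part : ∀ i → H (m ↑ʳ j) (i ↑ˡ k) ∧ lookup (x ++ y) (i ↑ˡ k) ≡ false
    G-part i rewrite H-FG j i | lookup-++ˡ x y i with i ≟ u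
    ... | yes refl rewrite xu≡0 = ∧-zeroʳ _
    ... | no _ = refl

  lift-v : ∀ y → lookup (lift y) v ≡ false
  lift-v y = insertAt-lookup y v false

  lift-punchIn : ∀ y j → lookup (lift y) (punchIn v j) ≡ lookup y j
  lift-punchIn y j = insertAt-punchIn y v false j

  module _ {W₁ : Subset m} {W₂ : Subset k} (u∉W₁ : lookup W₁ u ≡ false)
           {cH : Fin (m ℕ.+ k) → Bool} {cG : Fin m → Bool} {cF : Fin (suc k) → Bool}
           (cH-left : ∀ i → cH (i ↑ˡ k) ≡ cG i) (cH-right : ∀ j → cH (m ↑ʳ j) ≡ cF (punchIn v j)) where

    private
      ∈W₁⇒≢u : ∀ {i} → lookup W₁ i ≡ true → i ≢ u
      ∈W₁⇒≢u W₁i refl = true≢false (trans (sym W₁i) u∉W₁)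

      off-u : ∀ {x} → Solves G W₁ cG x → lookup x u ≡ false
      off-u {x} s with lookup x u in xu
      ... | true  = contradiction (supported s u xu) (λ W₁u → true≢false (trans (sym W₁u) u∉W₁))
      ... | false = refl

    solves-join : ∀ x y → Solves H (W₁ ++ W₂) cH (x ++ y) ⇔ (Solves G W₁ cG x × Solves F (lift W₂) cF (lift y))
    solves-join x y = mk⇔ to from
      where
      to : Solves H (W₁ ++ W₂) cH (x ++ y) → Solves G W₁ cG x × Solves F (lift W₂) cF (lift y)
      to s = sG , solves suppF satF
        where
        sG : Solves G W₁ cG x
        sG = solves (λ i xi → trans (sym (lookup-++ˡ W₁ W₂ i)) (supported s (i ↑ˡ k) (trans (lookup-++ˡ x y i) xi)))
                    (λ i W₁i → trans (sym (*ᵥ-left x y i (∈W₁⇒≢u W₁i)))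
                                     (trans (satisfied s (i ↑ˡ k) (trans (lookup-++ˡ W₁ W₂ i) W₁i)) (cH-left i)))
        suppF : lift y ⊆ lift W₂
        suppF a with punched v a
        ... | at      = λ yv → contradiction (trans (sym yv) (lift-v y)) true≢false
        ... | other j = λ yj → trans (lift-punchIn W₂ j) (trans (sym (lookup-++ʳ W₁ W₂ j))
                          (supported s (m ↑ʳ j) (trans (lookup-++ʳ x y j) (trans (sym (lift-punchIn y j)) yj))))
        satF : ∀ a → lookup (lift W₂) a ≡ true → (F *ᵥ lift y) a ≡ cF a
        satF a with punched v a
        ... | at      = λ W₂v → contradiction (trans (sym W₂v) (lift-v W₂)) true≢false
        ... | other j = λ W₂j → trans (sym (*ᵥ-right x y j (off-u sG)))
                          (trans (satisfied s (m ↑ʳ j) (trans (lookup-++ʳ W₁ W₂ j) (trans (sym (lift-punchIn W₂ j)) W₂j)))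
                                 (cH-right j))
      from : Solves G W₁ cG x × Solves F (lift W₂) cF (lift y) → Solves H (W₁ ++ W₂) cH (x ++ y)
      from (sG , sF) = solves supp sat
        where
        supp : x ++ y ⊆ W₁ ++ W₂
        supp a with split {m} {k} a
        ... | left i  = λ xi → trans (lookup-++ˡ W₁ W₂ i) (supported sG i (trans (sym (lookup-++ˡ x y i)) xi))
        ... | right j = λ yj → trans (lookup-++ʳ W₁ W₂ j) (trans (sym (lift-punchIn W₂ j))
                          (supported sF (punchIn v j) (trans (lift-punchIn y j) (trans (sym (lookup-++ʳ x y j)) yj))))
        sat : ∀ a → lookup (W₁ ++ W₂) a ≡ true → (H *ᵥ (x ++ y)) a ≡ cH a
        sat a with split {m} {k} a
        ... | left i  = λ Wi → let W₁i = trans (sym (lookup-++ˡ W₁ W₂ i)) Wi in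
                          trans (*ᵥ-left x y i (∈W₁⇒≢u W₁i)) (trans (satisfied sG i W₁i) (sym (cH-left i)))
        ... | right j = λ Wj → trans (*ᵥ-right x y j (off-u sG))
                          (trans (satisfied sF (punchIn v j) (trans (lift-punchIn W₂ j) (trans (sym (lookup-++ʳ W₁ W₂ j)) Wj)))
                                 (sym (cH-right j)))

    #solutions-join : #solutions H (W₁ ++ W₂) cH ≡ #solutions G W₁ cG ℕ.* #solutions F (lift W₂) cF
    #solutions-join = ℕΣ.cubeSum-join m k v {f = 𝟙 ∘ does ∘ solves? G W₁ cG} {g = 𝟙 ∘ does ∘ solves? F (lift W₂) cF}
      split-count vanish
      where
      split-count : ∀ x y → 𝟙 (does (solves? H (W₁ ++ W₂) cH (x ++ y)))
                            ≡ 𝟙 (does (solves? G W₁ cG x)) ℕ.* 𝟙 (does (solves? F (lift W₂) cF (lift y)))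
      split-count x y = trans
        (cong 𝟙 (does-⇔ (solves-join x y) (solves? H (W₁ ++ W₂) cH (x ++ y))
                                          (solves? G W₁ cG x ×-dec solves? F (lift W₂) cF (lift y))))
        (𝟙-∧ (does (solves? G W₁ cG x)) _)
      vanish : ∀ y → 𝟙 (does (solves? F (lift W₂) cF (insertAt y v true))) ≡ 0
      vanish y = cong 𝟙 (dec-false (solves? F (lift W₂) cF (insertAt y v true))
                                   (solves-outside v (insertAt-lookup y v true) (lift-v W₂)))

module _ {m k} {G : Graph m} {F : Graph (suc k)} {u : Fin m} {v : Fin (suc k)}
         (G-simple : IsSimple G) (F-simple : IsSimple F) where
  open OnePointJoin G F u v

  module _ (W₁ : Subset m) (W₂ : Subset k) (u∉W₁ : lookup W₁ u ≡ false) where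

    kernelSize-join : kernelSize H (W₁ ++ W₂) ≡ kernelSize G W₁ ℕ.* kernelSize F (lift W₂)
    kernelSize-join = #solutions-join {W₁} {W₂} u∉W₁ (λ _ → refl) (λ _ → refl)

    consistent-join : consistent H (W₁ ++ W₂) (u ↑ˡ k) ≡ consistent G W₁ u ∧ consistent F (lift W₂) v
    consistent-join = trans
      (cong positive (#solutions-join {W₁} {W₂} u∉W₁ {cF = column F v} (λ i → H-GG i u) H-FG-u))
      (positive-* (#solutions G W₁ (column G u)) (#solutions F (lift W₂) (column F v)))

    kernelDim-join : kernelDim H (W₁ ++ W₂) ≡ kernelDim G W₁ ℕ.+ kernelDim F (lift W₂)
    kernelDim-join =
      let (d , κG≡2^d) = kernelSize-power-of-two G-simple W₁
          (e , κF≡2^e) = kernelSize-power-of-two F-simple (lift W₂) in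
      trans (kernelDim-power-of-two H (W₁ ++ W₂) {d ℕ.+ e}
              (trans kernelSize-join (trans (cong₂ ℕ._*_ κG≡2^d κF≡2^e) (sym (ℕ.^-distribˡ-+-* 2 d e)))))
            (sym (cong₂ ℕ._+_ (kernelDim-power-of-two G W₁ {d} κG≡2^d) (kernelDim-power-of-two F (lift W₂) {e} κF≡2^e)))

  consistentSign-join : ∀ W₁ W₂ →
    consistentSign H (u ↑ˡ k) (W₁ ++ W₂) ≡ consistentSign G u W₁ * consistentSign F v (lift W₂)
  consistentSign-join W₁ W₂ rewrite lookup-++ˡ W₁ W₂ u | lift-v W₂ with lookup W₁ u in u∉W₁
  ... | true  = refl
  ... | false rewrite consistent-join W₁ W₂ u∉W₁ | kernelDim-join W₁ W₂ u∉W₁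
    with consistent G W₁ u | consistent F (lift W₂) v
  ...   | true  | true  = signℤ-+ (kernelDim G W₁) (kernelDim F (lift W₂))
  ...   | true  | false = sym (ℤ.*-zeroʳ (signℤ (kernelDim G W₁)))
  ...   | false | _     = refl

  ∑consistentSign-join : ℤΣ.cubeSum (m ℕ.+ k) (consistentSign H (u ↑ˡ k))
                       ≡ ℤΣ.cubeSum m (consistentSign G u) * ℤΣ.cubeSum (suc k) (consistentSign F v)
  ∑consistentSign-join = ℤΣ.cubeSum-join m k v {f = consistentSign G u} {g = consistentSign F v} consistentSign-join vanish
    where
    vanish : ∀ y → consistentSign F v (insertAt y v true) ≡ + 0
    vanish y rewrite insertAt-lookup y v true = refl

neighbour-≢ : ∀ {n} {K : Graph n} → IsSimple K → ∀ {u w} → K u w ≡ true → w ≢ u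
neighbour-≢ (_ , K-loopless) Kuw refl = true≢false (trans (sym Kuw) (K-loopless _))

proposition4p17 : (m k : ℕ) (G : Graph m) (F : Graph (suc k)) (u : Fin m) (v : Fin (suc k))
    → IsSimple G → IsSimple F → NonIsolated G u → NonIsolated F v
    → (+ 2) * γ (onePointJoin G F u v) ≡ γ G * γ F
proposition4p17 m k G F u v G-simple F-simple (g , ug) (f , vf) = begin
  + 2 * γ H
    ≡⟨ cong (+ 2 *_) (γ≡2*∑consistentSign (join-simple G-simple F-simple) g↑≢u↑) ⟩
  + 2 * (+ 2 * ℤΣ.cubeSum (m ℕ.+ k) (consistentSign H (u ↑ˡ k)))
    ≡⟨ cong (λ s → + 2 * (+ 2 * s)) (∑consistentSign-join G-simple F-simple) ⟩
  + 2 * (+ 2 * (σG * σF))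
    ≡⟨ regroup σG σF ⟩
  (+ 2 * σG) * (+ 2 * σF)
    ≡⟨ cong₂ _*_ (γ≡2*∑consistentSign G-simple (neighbour-≢ G-simple ug))
                 (γ≡2*∑consistentSign F-simple (neighbour-≢ F-simple vf)) ⟨
  γ G * γ F ∎
  where
  open OnePointJoin G F u v using (H; join-simple)
  σG σF : ℤ
  σG = ℤΣ.cubeSum m (consistentSign G u)
  σF = ℤΣ.cubeSum (suc k) (consistentSign F v)
  g↑≢u↑ : g ↑ˡ k ≢ u ↑ˡ k
  g↑≢u↑ = neighbour-≢ G-simple ug ∘ Fin.↑ˡ-injective k g u
  regroup : ∀ a b → + 2 * (+ 2 * (a * b)) ≡ (+ 2 * a) * (+ 2 * b)
  regroup = solve-∀
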